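{- Let $N\ge 1$. Let $C\equiv in.C'$, $C'\equiv out.C$ (an empty one-place cell), and for $i=0,\dots,N+1$ let $C_i\equiv C[\Phi_i]$, where $\Phi_i(in)=\delta_i$ if $0\le i\le N$, $\Phi_i(out)=\delta_{i-1}$ if $1\le i\le N+1$, and $\Phi_i(\alpha)=\alpha$ otherwise (here $\delta_0,\dots,\delta_{N+1}$ are distinct visible actions different from $in,out,\omega$). Let $\mathit{Pipe}\equiv (C_0\|_{\{\delta_0\}}C_1\|_{\{\delta_1\}}\cdots\|_{\{\delta_N\}}C_{N+1})/A$ with $A=\{\delta_0,\dots,\delta_{N+1}\}$, where $P/A$ denotes $P[\Phi_A]$ with $\Phi_A(\alpha)=\tau$ for $\alpha\in A$ and $\Phi_A(\alpha)=\alpha$ otherwise. Then the asymptotic performance of $\mathit{Pipe}$ is $2$, and for every $N\ge 1$, $rp_{\mathit{Pipe}}(n)=2n+(N+1)$ for all $n\ge 1$.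
   Context: PAFAS (a timed process algebra). $\mathcal{A}$ is an infinite set of visible actions containing a special success action $\omega$ and the actions $in, out$; $\tau\notin\mathcal{A}$ is the internal action, $\mathcal{A}_\tau=\mathcal{A}\cup\{\tau\}$. For each $\alpha\in\mathcal{A}_\tau$ there is an urgent version $\underline{\alpha}$. A general relabelling function is $\Phi:\mathcal{A}_\tau\to\mathcal{A}_\tau$ with $\Phi(\tau)=\tau$ changing only finitely many actions. Processes are closed, guarded terms of the grammar $P ::= \mathbf{0} \mid \gamma.P \mid P+P \mid P\|_A P \mid P[\Phi] \mid x \mid \mu x.P$ with $\gamma\in\{\alpha,\underline{\alpha}\}$, $\alpha\in\mathcal{A}_\tau$, $A\subseteq\mathcal{A}$; recursive defining equations ($\equiv$) abbreviate $\mu$-terms, and a trailing $\mathbf 0$ is omitted. $P\|Q$ abbreviates $P\|_{\mathcal{A}\setminus\{\omega\}}Q$. Refusal semantics: transitions $P\xrightarrow{\alpha}_r P'$ ($\alpha\in\mathcal{A}_\tau$) and $P\xrightarrow{X}_r P'$ ($X\subseteq\mathcal{A}$) are the least relations closed under: $\alpha.P\xrightarrow{\alpha}_r P$; $\underline{\alpha}.P\xrightarrow{\alpha}_r P$; if $P_1\xrightarrow{\alpha}_r P_1'$ then $P_1+P_2\xrightarrow{\alpha}_r P_1'$ and $P_2+P_1\xrightarrow{\alpha}_r P_1'$; if $\alpha\notin A$ and $P_1\xrightarrow{\alpha}_r P_1'$ then $P_1\|_A P_2\xrightarrow{\alpha}_r P_1'\|_A P_2$ and $P_2\|_A P_1\xrightarrow{\alpha}_r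 P_2\|_A P_1'$; if $\alpha\in A$, $P_1\xrightarrow{\alpha}_r P_1'$, $P_2\xrightarrow{\alpha}_r P_2'$ then $P_1\|_A P_2\xrightarrow{\alpha}_r P_1'\|_A P_2'$; if $P\xrightarrow{\alpha}_r P'$ then $P[\Phi]\xrightarrow{\Phi(\alpha)}_r P'[\Phi]$; if $P\{\mu x.P/x\}\xrightarrow{\alpha}_r P'$ then $\mu x.P\xrightarrow{\alpha}_r P'$; $\mathbf 0\xrightarrow{X}_r\mathbf 0$; $\alpha.P\xrightarrow{X}_r\underline{\alpha}.P$; if $\alpha\notin X\cup\{\tau\}$ then $\underline{\alpha}.P\xrightarrow{X}_r\underline{\alpha}.P$; if $P_i\xrightarrow{X_i}_r P_i'$ ($i=1,2$) and $X\subseteq (A\cap(X_1\cup X_2))\cup((X_1\cap X_2)\setminus A)$ then $P_1\|_A P_2\xrightarrow{X}_r P_1'\|_A P_2'$; if $P_i\xrightarrow{X}_r P_i'$ ($i=1,2$) then $P_1+P_2\xrightarrow{X}_r P_1'+P_2'$; if $P\xrightarrow{\Phi^{ -1}(X\cup\{\tau\})\setminus\{\tau\}}_r P'$ then $P[\Phi]\xrightarrow{X}_r P'[\Phi]$; if $P\{\mu x.P/x\}\xrightarrow{X}_r P'$ then $\mu x.P\xrightarrow{X}_r P'\{\mu x.P/x\}$. A full time step $P\xrightarrow{1}P'$ is $P\xrightarrow{\mathcal{A}}_r P'$. For $w\in(\mathcal{A}_\tau\cup\{1\})^*$, $P\xrightarrow{w}P'$ is the corresponding sequence of action transitions and full time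 steps; the discrete traces are $DL(P)=\{w/\tau : P\xrightarrow{w}P' \text{ for some } P'\}$ where $w/\tau$ deletes all $\tau$'s; $\zeta(v)$ is the number of $1$'s in $v$. Users: $U_1\equiv\underline{in}.\underline{out}.\underline{\omega}$, $U_n\equiv U_{n-1}\|_{\{\omega\}}\underline{in}.\underline{out}.\underline{\omega}$ for $n>1$. Response performance: $rp_P(n)=\sup\{\zeta(v) : v\in DL(P\|U_n),\ v \text{ does not contain }\omega\}\in\mathbb{N}_0\cup\{\infty\}$. The asymptotic performance of $P$ is the $a\in\mathbb{R}$ with $rp_P(n)=an+\Theta(1)$. -}

module Defs where

open import Data.Nat using (ℕ; zero; suc; _+_; _*_; _≤_; pred; _≡ᵇ_; _≤ᵇ_)
open import Data.Bool using (Bool; true; false; _∧_; not; if_then_else_)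
open import Data.List using (List; []; _∷_; upTo)
open import Data.Bool.ListAction using (any)
open import Data.List.Membership.Propositional using (_∈_)
open import Data.Product using (Σ; ∃; _×_; _,_)
open import Data.Sum using (_⊎_)
open import Data.Unit using (⊤)
open import Relation.Nullary using (¬_)
open import Relation.Binary.PropositionalEquality using (_≡_)

Vis : Set
Vis = ℕ

inA outA ωA : Vis
inA  = 0
outA = 1
ωA   = 2

data ActT : Set where
  τ   : ActT
  vis : Vis → ActT

data Pref : Set where
  lazy   : ActT → Pref
  urgent : ActT → Pref

-- Process terms (de Bruijn recursion variables).
-- Synchronisation sets A ⊆ 𝒜 are decidable predicates Vis → Bool;
-- relabellings are functions Φ : 𝒜_τ → 𝒜_τ.

data Proc : Set where
  nil   : Proc
  pre   : Pref → Proc → Proc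
  _⊕_   : Proc → Proc → Proc
  par   : Proc → (Vis → Bool) → Proc → Proc
  relab : Proc → (ActT → ActT) → Proc
  var   : ℕ → Proc
  mu    : Proc → Proc

-- substitution P{Q/x_k} of a closed term Q for the de Bruijn variable k
subst : ℕ → Proc → Proc → Proc
subst k Q nil = nil
subst k Q (pre γ P) = pre γ (subst k Q P)
subst k Q (P₁ ⊕ P₂) = subst k Q P₁ ⊕ subst k Q P₂
subst k Q (par P₁ A P₂) = par (subst k Q P₁) A (subst k Q P₂)
subst k Q (relab P Φ) = relab (subst k Q P) Φ
subst k Q (var m) =
  if m ≡ᵇ k then Q else (if suc k ≤ᵇ m then var (pred m) else var m)
subst k Q (mu P) = mu (subst (suc k) Q P)

unfold : Proc → Proc
unfold P = subst 0 (mu P) P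

inSync : (Vis → Bool) → ActT → Bool
inSync A τ = false
inSync A (vis a) = A a

-- Φ⁻¹(X ∪ {τ}) \ {τ}, as a subset of 𝒜
inXτ : (Vis → Set) → ActT → Set
inXτ X τ = ⊤
inXτ X (vis b) = X b

preimg : (ActT → ActT) → (Vis → Set) → Vis → Set
preimg Φ X a = inXτ X (Φ (vis a))

infix 4 _-[_]→_ _=[_]⇒_

data _-[_]→_ : Proc → ActT → Proc → Set where
  preL : ∀ {α P} → pre (lazy α) P -[ α ]→ P
  preU : ∀ {α P} → pre (urgent α) P -[ α ]→ P
  sumL : ∀ {α P₁ P₁' P₂} → P₁ -[ α ]→ P₁' → (P₁ ⊕ P₂) -[ α ]→ P₁'
  sumR : ∀ {α P₁ P₁' P₂} → P₁ -[ α ]→ P₁' → (P₂ ⊕ P₁) -[ α ]→ P₁'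
  parL : ∀ {α A P₁ P₁' P₂} → inSync A α ≡ false → P₁ -[ α ]→ P₁' →
         par P₁ A P₂ -[ α ]→ par P₁' A P₂
  parR : ∀ {α A P₁ P₁' P₂} → inSync A α ≡ false → P₁ -[ α ]→ P₁' →
         par P₂ A P₁ -[ α ]→ par P₂ A P₁'
  parS : ∀ {α A P₁ P₁' P₂ P₂'} → inSync A α ≡ true →
         P₁ -[ α ]→ P₁' → P₂ -[ α ]→ P₂' → par P₁ A P₂ -[ α ]→ par P₁' A P₂'
  rel  : ∀ {α Φ P P'} → P -[ α ]→ P' → relab P Φ -[ Φ α ]→ relab P' Φ
  rec  : ∀ {α P P'} → unfold P -[ α ]→ P' → mu P -[ α ]→ P'

data _=[_]⇒_ : Proc → (Vis → Set) → Proc → Set₁ where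
  nilR : ∀ {X} → nil =[ X ]⇒ nil
  preLR : ∀ {X α P} → pre (lazy α) P =[ X ]⇒ pre (urgent α) P
  preUR : ∀ {X a P} → ¬ X a → pre (urgent (vis a)) P =[ X ]⇒ pre (urgent (vis a)) P
  parR : ∀ {X X₁ X₂ A P₁ P₁' P₂ P₂'} →
         P₁ =[ X₁ ]⇒ P₁' → P₂ =[ X₂ ]⇒ P₂' →
         (∀ a → X a → (A a ≡ true × (X₁ a ⊎ X₂ a)) ⊎ (A a ≡ false × X₁ a × X₂ a)) →
         par P₁ A P₂ =[ X ]⇒ par P₁' A P₂'
  sumR : ∀ {X P₁ P₁' P₂ P₂'} → P₁ =[ X ]⇒ P₁' → P₂ =[ X ]⇒ P₂' →
         (P₁ ⊕ P₂) =[ X ]⇒ (P₁' ⊕ P₂')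
  relR : ∀ {X Φ P P'} → P =[ preimg Φ X ]⇒ P' → relab P Φ =[ X ]⇒ relab P' Φ
  recR : ∀ {X P P'} → unfold P =[ X ]⇒ P' → mu P =[ X ]⇒ subst 0 (mu P) P'

fullTime : Vis → Set
fullTime _ = ⊤

data Lab : Set where
  act  : ActT → Lab
  tick : Lab

data Steps : Proc → List Lab → Proc → Set₁ where
  done : ∀ {P} → Steps P [] P
  stepA : ∀ {P α P' w P''} → P -[ α ]→ P' → Steps P' w P'' → Steps P (act α ∷ w) P''
  stepT : ∀ {P P' w P''} → P =[ fullTime ]⇒ P' → Steps P' w P'' → Steps P (tick ∷ w) P''

data Obs : Set where
  ovis  : Vis → Obs
  otick : Obs

eraseτ : List Lab → List Obs
eraseτ [] = []
eraseτ (act τ ∷ w) = eraseτ w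
eraseτ (act (vis a) ∷ w) = ovis a ∷ eraseτ w
eraseτ (tick ∷ w) = otick ∷ eraseτ w

InDL : Proc → List Obs → Set₁
InDL P v = Σ (List Lab) λ w → Σ Proc λ P' → Steps P w P' × eraseτ w ≡ v

ζ : List Obs → ℕ
ζ [] = 0
ζ (ovis _ ∷ v) = ζ v
ζ (otick ∷ v) = suc (ζ v)

ωset : Vis → Bool
ωset a = a ≡ᵇ ωA

notω : Vis → Bool
notω a = not (a ≡ᵇ ωA)

_∥_ : Proc → Proc → Proc
P ∥ Q = par P notω Q

user : Proc
user = pre (urgent (vis inA)) (pre (urgent (vis outA)) (pre (urgent (vis ωA)) nil))

-- U n for n ≥ 1 (U 0 is an unused dummy)
U : ℕ → Proc
U zero = nil
U (suc zero) = user
U (suc (suc m)) = par (U (suc m)) ωset user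

RPis : Proc → ℕ → ℕ → Set₁
RPis P n k =
  (∀ v → InDL (P ∥ U n) v → ¬ (ovis ωA ∈ v) → ζ v ≤ k) ×
  (Σ (List Obs) λ v → InDL (P ∥ U n) v × ¬ (ovis ωA ∈ v) × ζ v ≡ k)

-- asymptotic performance of P is the natural number a:
-- rp_P(n) = a·n + Θ(1), i.e. rp_P(n) is finite and |rp_P(n) − a·n| is bounded
AsymptoticPerformance : Proc → ℕ → Set₁
AsymptoticPerformance P a =
  Σ ℕ λ c → ∀ n → 1 ≤ n →
    Σ ℕ λ k → RPis P n k × k ≤ a * n + c × a * n ≤ k + c

cellC : Proc
cellC = mu (pre (lazy (vis inA)) (pre (lazy (vis outA)) (var 0)))

Φcell : ℕ → (ℕ → Vis) → ℕ → ActT → ActT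
Φcell N δ i τ = τ
Φcell N δ i (vis a) =
  if (a ≡ᵇ inA) ∧ (i ≤ᵇ N) then vis (δ i)
  else (if (a ≡ᵇ outA) ∧ (1 ≤ᵇ i) then vis (δ (pred i)) else vis a)

cellAt : ℕ → (ℕ → Vis) → ℕ → Proc
cellAt N δ i = relab cellC (Φcell N δ i)

chain : ℕ → (ℕ → Vis) → ℕ → Proc
chain N δ zero = cellAt N δ 0
chain N δ (suc k) = par (chain N δ k) (λ a → a ≡ᵇ δ k) (cellAt N δ (suc k))

hideΦ : ℕ → (ℕ → Vis) → ActT → ActT
hideΦ N δ τ = τ
hideΦ N δ (vis a) = if any (λ i → δ i ≡ᵇ a) (upTo (suc (suc N))) then τ else vis a

Pipe : ℕ → (ℕ → Vis) → Proc
Pipe N δ = relab (chain N δ (suc N)) (hideΦ N δ)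

-- A state of Pipe ∥ U_n is described by the states of the N + 2 cells and by how many users still
-- have to perform in and out; the number of full cells always equals the number of users waiting
-- for out, and the users waiting for in act like one more full cell behind the input end.
-- The pipeline moves one item per two time steps, so a full cell at position x with b items behind
-- it accounts for at most x + 2b + 2 further time steps. The maximum Pot⁺ of these amounts never
-- grows under actions and drops by exactly one per time step, and time can only pass while it is at
-- least 2: this bounds the number of time steps before the first ω. Conversely, the run that performs
-- every urgent action at once and otherwise lets time pass loses at most one unit per time step of a
-- variant Pot⁻. Both potentials start at 2n + N + 2.

module Submission where

open import Defs hiding (subst)
open import Data.Nat using (ℕ; zero; suc; _+_; _*_; _≤_; _<_; z≤n; s≤s; pred; _⊔_; _≡ᵇ_; _≤ᵇ_)
open import Data.Nat.Properties
open import Data.Bool using (Bool; true; false; T; if_then_else_)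
open import Data.Product using (Σ; _×_; _,_; proj₁; proj₂)
open import Data.Sum using (_⊎_; inj₁; inj₂)
open import Data.Empty using (⊥-elim)
open import Data.Unit using (tt)
open import Relation.Nullary using (¬_; yes; no)
open import Relation.Binary.PropositionalEquality
open import Data.Nat.Tactic.RingSolver using (solve-∀)
open import Data.Bool.ListAction using (any)
open import Data.Bool.Properties using (∨-zeroʳ)
open import Data.List using (List; []; _∷_; applyUpTo)
open import Data.List.Membership.Propositional using (_∈_)
open import Data.List.Relation.Unary.Any using (here; there)
open import Function using (id; _∘_)

≡true⇒T : ∀ {b} → b ≡ true → T b
≡true⇒T refl = tt

T⇒≡true : ∀ {b} → T b → b ≡ true
T⇒≡true {true} _ = refl

≡ᵇ-refl : ∀ n → (n ≡ᵇ n) ≡ true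
≡ᵇ-refl zero = refl
≡ᵇ-refl (suc n) = ≡ᵇ-refl n

≡ᵇ-true⇒≡ : ∀ m n → (m ≡ᵇ n) ≡ true → m ≡ n
≡ᵇ-true⇒≡ m n e = ≡ᵇ⇒≡ m n (≡true⇒T e)

≢⇒≡ᵇ-false : ∀ m n → m ≢ n → (m ≡ᵇ n) ≡ false
≢⇒≡ᵇ-false m n m≢n with m ≡ᵇ n in eq
... | true = ⊥-elim (m≢n (≡ᵇ-true⇒≡ m n eq))
... | false = refl

≡ᵇ-false⇒≢ : ∀ {m n} → (m ≡ᵇ n) ≡ false → m ≢ n
≡ᵇ-false⇒≢ {m} eq refl with trans (sym (≡ᵇ-refl m)) eq
... | ()

any-applyUpTo-false : ∀ (p : ℕ → Bool) (f : ℕ → ℕ) m → (∀ i → i < m → p (f i) ≡ false) →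
  any p (applyUpTo f m) ≡ false
any-applyUpTo-false p f zero _ = refl
any-applyUpTo-false p f (suc m) h rewrite h 0 (s≤s z≤n) =
  any-applyUpTo-false p (f ∘ suc) m (λ i i<m → h (suc i) (s≤s i<m))

any-applyUpTo-true : ∀ (p : ℕ → Bool) (f : ℕ → ℕ) m i → i < m → p (f i) ≡ true →
  any p (applyUpTo f m) ≡ true
any-applyUpTo-true p f (suc m) zero _ e rewrite e = refl
any-applyUpTo-true p f (suc m) (suc i) (s≤s i<m) e rewrite any-applyUpTo-true p (f ∘ suc) m i i<m e = ∨-zeroʳ (p (f 0))

1≤+ : ∀ x y → 1 ≤ x + y → 1 ≤ x ⊎ 1 ≤ y
1≤+ zero y p = inj₂ p
1≤+ (suc x) y p = inj₁ (s≤s z≤n)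

+-shuffle : ∀ x B n → (x + B) + n ≡ B + (n + x)
+-shuffle = solve-∀

3+k+2m≡2[1+m]+[k+1] : ∀ k m → suc (suc (suc k) + (m + m)) ≡ 2 * suc m + (k + 1)
3+k+2m≡2[1+m]+[k+1] = solve-∀

suc≤pred : ∀ {z P} → 2 ≤ P → z ≤ pred (pred P) → suc z ≤ pred P
suc≤pred {P = suc zero} (s≤s ()) _
suc≤pred {P = suc (suc _)} _ z≤ = s≤s z≤

pred<-≤ : ∀ {P f} → 1 ≤ P → P ≤ f → pred P < f
pred<-≤ {suc _} _ P≤f = P≤f

pred≤suc-pred : ∀ {P} X → P ≤ suc X → pred P ≤ suc (pred X)
pred≤suc-pred zero P≤1 = ≤-trans (pred-mono-≤ P≤1) z≤n
pred≤suc-pred (suc _) P≤ = pred-mono-≤ P≤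

vis-injective : ∀ {a b} → vis a ≡ vis b → a ≡ b
vis-injective refl = refl

retarget : ∀ {P Q α β} → α ≡ β → P -[ α ]→ Q → P -[ β ]→ Q
retarget refl s = s

-- The flag records whether the pending prefix of the cell (in when empty, out when full) has
-- already become urgent, which it does at the first time step.
data Cell : Set where
  empty full : Bool → Cell

cellProc : Cell → Proc
cellProc (empty false) = cellC
cellProc (empty true) = pre (urgent (vis inA)) (pre (lazy (vis outA)) cellC)
cellProc (full false) = pre (lazy (vis outA)) cellC
cellProc (full true) = pre (urgent (vis outA)) cellC

-- `Cells k` lists the states of C₀, …, C_k; C_k is the input end and C₀ performs `out`.
infixl 5 _▷_
data Cells : ℕ → Set where
  [_] : Cell → Cells zero
  _▷_ : ∀ {k} → Cells k → Cell → Cells (suc k)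

urgentCell : Cell → Cell
urgentCell (empty _) = empty true
urgentCell (full _) = full true

urgentCells : ∀ {k} → Cells k → Cells k
urgentCells [ c ] = [ urgentCell c ]
urgentCells (cs ▷ c) = urgentCells cs ▷ urgentCell c

inputCell outputCell : ∀ {k} → Cells k → Cell
inputCell [ c ] = c
inputCell (cs ▷ c) = c
outputCell [ c ] = c
outputCell (cs ▷ c) = outputCell cs

inputCell-urgentCells : ∀ {k} (cs : Cells k) → inputCell (urgentCells cs) ≡ urgentCell (inputCell cs)
inputCell-urgentCells [ c ] = refl
inputCell-urgentCells (cs ▷ c) = refl

data Move : Set where
  input output : Move
  pass : ℕ → Move

-- `pass i`: C_{i+1} hands its item to C_i over the hidden channel δ_i.
data Step : ∀ {k} → Cells k → Move → Cells k → Set where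
  input₀  : ∀ {u} → Step [ empty u ] input [ full false ]
  input▷  : ∀ {k} {cs : Cells k} {u} → Step (cs ▷ empty u) input (cs ▷ full false)
  output₀ : ∀ {u} → Step [ full u ] output [ empty false ]
  output◁ : ∀ {k} {cs cs' : Cells k} {c} → Step cs output cs' → Step (cs ▷ c) output (cs' ▷ c)
  pass◁   : ∀ {k} {cs cs' : Cells k} {c i} → Step cs (pass i) cs' → Step (cs ▷ c) (pass i) (cs' ▷ c)
  pass▷   : ∀ {k} {cs cs' : Cells k} {u} → Step cs input cs' → Step (cs ▷ full u) (pass k) (cs' ▷ empty false)

pass-index : ∀ {k} {cs cs' : Cells k} {i} → Step cs (pass i) cs' → i < k
pass-index (pass◁ st) = m<n⇒m<1+n (pass-index st)
pass-index (pass▷ st) = ≤-refl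

input-fills : ∀ {k} {xs ys : Cells k} → Step xs input ys → inputCell ys ≡ full false
input-fills input₀ = refl
input-fills input▷ = refl

-- Both prefixes of δ_i are urgent, so no time step is possible before this pass.
data PassDue : ∀ {k} → Cells k → ℕ → Set where
  due▷ : ∀ {k} {cs : Cells k} → inputCell cs ≡ empty true → PassDue (cs ▷ full true) k
  due◁ : ∀ {k} {cs : Cells k} {c i} → PassDue cs i → PassDue (cs ▷ c) i

passDue-index : ∀ {k} {cs : Cells k} {i} → PassDue cs i → i < k
passDue-index (due▷ _) = ≤-refl
passDue-index (due◁ d) = m<n⇒m<1+n (passDue-index d)

NothingDue : ∀ {k} → Cells k → Set
NothingDue cs = (∀ i → ¬ PassDue cs i) × outputCell cs ≢ full true

occupancy urgency : Cell → ℕ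
occupancy (empty _) = 0
occupancy (full _) = 1
urgency (empty false) = 0
urgency (empty true) = 1
urgency (full false) = 0
urgency (full true) = 1

#full #urgent : ∀ {k} → Cells k → ℕ
#full [ c ] = occupancy c
#full (cs ▷ c) = #full cs + occupancy c
#urgent [ c ] = urgency c
#urgent (cs ▷ c) = #urgent cs + urgency c

occupancy-urgentCell : ∀ c → occupancy (urgentCell c) ≡ occupancy c
occupancy-urgentCell (empty _) = refl
occupancy-urgentCell (full _) = refl

#full-urgentCells : ∀ {k} (cs : Cells k) → #full (urgentCells cs) ≡ #full cs
#full-urgentCells [ c ] = occupancy-urgentCell c
#full-urgentCells (cs ▷ c) = cong₂ _+_ (#full-urgentCells cs) (occupancy-urgentCell c)

#full-input : ∀ {k} {xs ys : Cells k} → Step xs input ys → #full ys ≡ suc (#full xs)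
#full-input input₀ = refl
#full-input (input▷ {cs = cs}) = +-suc (#full cs) 0

#full-output : ∀ {k} {xs ys : Cells k} → Step xs output ys → #full xs ≡ suc (#full ys)
#full-output output₀ = refl
#full-output (output◁ {c = c} st) = cong (_+ occupancy c) (#full-output st)

#full-pass : ∀ {k} {xs ys : Cells k} {i} → Step xs (pass i) ys → #full ys ≡ #full xs
#full-pass (pass◁ {c = c} st) = cong (_+ occupancy c) (#full-pass st)
#full-pass (pass▷ {cs = cs} st) = trans (+-identityʳ _) (trans (#full-input st) (+-comm 1 (#full cs)))

#full≡0⇒inputCell-empty : ∀ {k} (cs : Cells k) → #full cs ≡ 0 → Σ Bool λ u → inputCell cs ≡ empty u
#full≡0⇒inputCell-empty [ empty u ] _ = u , refl
#full≡0⇒inputCell-empty (cs ▷ empty u) _ = u , refl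
#full≡0⇒inputCell-empty (cs ▷ full u) e with trans (sym (+-suc (#full cs) 0)) e
... | ()

outputCell-full⇒#full≥1 : ∀ {k} (cs : Cells k) {u} → outputCell cs ≡ full u → 1 ≤ #full cs
outputCell-full⇒#full≥1 [ full u ] _ = ≤-refl
outputCell-full⇒#full≥1 (cs ▷ c) e = ≤-trans (outputCell-full⇒#full≥1 cs e) (m≤m+n _ _)

-- Steps both of whose partners are urgent; they must happen before the next time step.
data Forced : ∀ {k} → Cells k → Move → Cells k → Set where
  output₀! : Forced [ full true ] output [ empty false ]
  output◁! : ∀ {k} {cs cs' : Cells k} {c} → Forced cs output cs' → Forced (cs ▷ c) output (cs' ▷ c)
  pass◁!   : ∀ {k} {cs cs' : Cells k} {c i} → Forced cs (pass i) cs' → Forced (cs ▷ c) (pass i) (cs' ▷ c)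
  pass▷₀!  : Forced ([ empty true ] ▷ full true) (pass 0) ([ full false ] ▷ empty false)
  pass▷!   : ∀ {k} {cs : Cells k} →
             Forced (cs ▷ empty true ▷ full true) (pass (suc k)) (cs ▷ full false ▷ empty false)

forced-step : ∀ {k} {xs ys : Cells k} {m} → Forced xs m ys → Step xs m ys
forced-step output₀! = output₀
forced-step (output◁! f) = output◁ (forced-step f)
forced-step (pass◁! f) = pass◁ (forced-step f)
forced-step pass▷₀! = pass▷ input₀
forced-step pass▷! = pass▷ input▷

forced-¬input : ∀ {k} {xs ys : Cells k} {m} → Forced xs m ys → m ≢ input
forced-¬input output₀! ()
forced-¬input (output◁! _) ()
forced-¬input (pass◁! _) ()
forced-¬input pass▷₀! ()
forced-¬input pass▷! ()

forced-#urgent : ∀ {k} {xs ys : Cells k} {m} → Forced xs m ys → #urgent ys < #urgent xs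
forced-#urgent output₀! = s≤s z≤n
forced-#urgent (output◁! {c = c} f) = +-monoˡ-< (urgency c) (forced-#urgent f)
forced-#urgent (pass◁! {c = c} f) = +-monoˡ-< (urgency c) (forced-#urgent f)
forced-#urgent pass▷₀! = s≤s z≤n
forced-#urgent (pass▷! {cs = cs}) rewrite +-identityʳ (#urgent cs + 0) | +-identityʳ (#urgent cs) | +-comm (#urgent cs) 1 =
  m≤m+n _ 1

forced-▷ : ∀ {k} {cs cs' : Cells k} {c m} → Forced cs m cs' → Forced (cs ▷ c) m (cs' ▷ c)
forced-▷ f@output₀! = output◁! f
forced-▷ f@(output◁! _) = output◁! f
forced-▷ f@(pass◁! _) = pass◁! f
forced-▷ f@pass▷₀! = pass◁! f
forced-▷ f@pass▷! = pass◁! f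

forced-pass▷ : ∀ {k} (cs : Cells k) → inputCell cs ≡ empty true →
  Σ (Cells (suc k)) λ ys → Forced (cs ▷ full true) (pass k) ys
forced-pass▷ [ empty true ] _ = _ , pass▷₀!
forced-pass▷ (cs ▷ empty true) _ = _ , pass▷!

due? : ∀ l c → (l ≡ empty true × c ≡ full true) ⊎ (l ≢ empty true ⊎ c ≢ full true)
due? (empty true)  (full true)  = inj₁ (refl , refl)
due? (empty true)  (full false) = inj₂ (inj₂ λ ())
due? (empty true)  (empty _)    = inj₂ (inj₂ λ ())
due? (empty false) c            = inj₂ (inj₁ λ ())
due? (full _)      c            = inj₂ (inj₁ λ ())

forced-or-nothingDue : ∀ {k} (xs : Cells k) → (Σ Move λ m → Σ (Cells k) λ ys → Forced xs m ys) ⊎ NothingDue xs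
forced-or-nothingDue [ full true ] = inj₁ (output , _ , output₀!)
forced-or-nothingDue [ full false ] = inj₂ ((λ _ ()) , λ ())
forced-or-nothingDue [ empty _ ] = inj₂ ((λ _ ()) , λ ())
forced-or-nothingDue (_▷_ {k} cs c) with forced-or-nothingDue cs
... | inj₁ (m , ys , f) = inj₁ (m , ys ▷ c , forced-▷ f)
... | inj₂ (¬due , ¬outputDue) with due? (inputCell cs) c
...   | inj₁ (ready , refl) = inj₁ (pass k , forced-pass▷ cs ready)
...   | inj₂ not-due = inj₂ (¬due▷ not-due , ¬outputDue)
  where
  ¬due▷ : inputCell cs ≢ empty true ⊎ c ≢ full true → ∀ i → ¬ PassDue (cs ▷ c) i
  ¬due▷ (inj₁ ¬ready) i (due▷ ready) = ¬ready ready
  ¬due▷ (inj₂ ¬full) i (due▷ _) = ¬full refl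
  ¬due▷ _ i (due◁ d) = ¬due i d

output-empties : ∀ {k} {xs ys : Cells k} → Forced xs output ys → outputCell ys ≡ empty false
output-empties output₀! = refl
output-empties (output◁! f) = output-empties f

input-forced : ∀ {k} (cs : Cells (suc k)) → inputCell cs ≡ empty true →
  Σ (Cells (suc k)) λ cs' → Step cs input cs' × #urgent cs' < #urgent cs ×
                            Forced (cs ▷ full true) (pass (suc k)) (cs' ▷ empty false)
input-forced (cs ▷ empty true) _ = cs ▷ full false , input▷ , +-monoʳ-< (#urgent cs) (s≤s z≤n) , pass▷!

Cost : Set
Cost = Cell → Cell → ℕ → ℕ → ℕ

-- `cost ahead c x b` is charged to the cell c at index x, whose neighbour towards the output is
-- `ahead` (beyond C₀ the users act like an urgent empty cell) and behind which b items wait.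
potential : Cost → ∀ {k} → Cells k → ℕ → ℕ
potential cost [ c ] b = cost (empty true) c 0 b
potential cost (_▷_ {k} cs c) b = cost (inputCell cs) c (suc k) b ⊔ potential cost cs (occupancy c + b)

potential-#full≡0 : ∀ cost → (∀ l u x b → cost l (empty u) x b ≡ 0) →
  ∀ {k} (cs : Cells k) b → #full cs ≡ 0 → potential cost cs b ≡ 0
potential-#full≡0 cost free [ empty u ] b _ = free _ u 0 b
potential-#full≡0 cost free (cs ▷ empty u) b e =
  cong₂ _⊔_ (free _ u _ b) (potential-#full≡0 cost free cs b (trans (sym (+-identityʳ _)) e))
potential-#full≡0 cost free (cs ▷ full u) b e with trans (sym (+-suc (#full cs) 0)) e
... | ()

-- One time step less is charged when the cell and its neighbour are both urgent, since the
-- pass between them happens before time can pass.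
cost⁺ : Cost
cost⁺ _             (empty _)    x b = 0
cost⁺ (empty true)  (full true)  x b = suc (x + (b + b))
cost⁺ (empty true)  (full false) x b = suc (suc (x + (b + b)))
cost⁺ (empty false) (full _)     x b = suc (suc (x + (b + b)))
cost⁺ (full _)      (full _)     x b = 0

cost⁻ : Cost
cost⁻ _             (empty _)    x b = 0
cost⁻ (empty true)  (full true)  x b = suc (x + (b + b))
cost⁻ (empty true)  (full false) x b = suc (suc (x + (b + b)))
cost⁻ (empty false) (full _)     x b = suc (suc (x + (b + b)))
cost⁻ (full _)      (full _)     x b = suc (suc (x + (b + b)))

pot⁺ pot⁻ : ∀ {k} → Cells k → ℕ → ℕ
pot⁺ = potential cost⁺
pot⁻ = potential cost⁻

cost⁺-≤ : ∀ l c x b → cost⁺ l c x b ≤ suc (suc (x + (b + b)))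
cost⁺-≤ _             (empty _)    x b = z≤n
cost⁺-≤ (empty true)  (full true)  x b = n≤1+n _
cost⁺-≤ (empty true)  (full false) x b = ≤-refl
cost⁺-≤ (empty false) (full _)     x b = ≤-refl
cost⁺-≤ (full _)      (full _)     x b = z≤n

cost⁺-behind-empty : ∀ u' u x b → suc (x + (b + b)) ≤ cost⁺ (empty u') (full u) x b
cost⁺-behind-empty true  true  x b = ≤-refl
cost⁺-behind-empty true  false x b = n≤1+n _
cost⁺-behind-empty false u     x b = n≤1+n _

cost⁺-urgentCell : ∀ l c x b → ¬ (l ≡ empty true × c ≡ full true) →
  cost⁺ (urgentCell l) (urgentCell c) x b ≡ pred (cost⁺ l c x b)
cost⁺-urgentCell l             (empty _)    x b _ = refl
cost⁺-urgentCell (empty true)  (full true)  x b h = ⊥-elim (h (refl , refl))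
cost⁺-urgentCell (empty true)  (full false) x b _ = refl
cost⁺-urgentCell (empty false) (full _)     x b _ = refl
cost⁺-urgentCell (full _)      (full _)     x b _ = refl

-- When a step empties the input cell C_K, the cost of a cell appended behind it grows to the
-- lazy-neighbour value; the second disjunct says the old potential already pays for that.
Pot⁺Descent : ∀ {K} → Cells K → Cells K → ℕ → Set
Pot⁺Descent {K} xs ys b =
  pot⁺ ys b ≤ pot⁺ xs b ×
  (inputCell ys ≡ inputCell xs ⊎ (inputCell ys ≡ empty false × ∀ b' → suc (K + (b' + b')) ≤ pot⁺ xs b'))

pot⁺-descent-▷ : ∀ {k} {cs cs' : Cells k} c b → Pot⁺Descent cs cs' (occupancy c + b) →
  Pot⁺Descent (cs ▷ c) (cs' ▷ c) b
pot⁺-descent-▷ c b (le , inj₁ same) rewrite same = ⊔-monoʳ-≤ _ le , inj₁ refl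
pot⁺-descent-▷ {k} {cs} c b (le , inj₂ (emptied , paid)) rewrite emptied =
  ⊔-lub (≤-trans (appended-cost c) (m≤n⊔m _ _)) (≤-trans le (m≤n⊔m _ _)) , inj₁ refl
  where
  shift : ∀ k b → suc (suc (suc k + (b + b))) ≡ suc (k + (suc b + suc b))
  shift = solve-∀
  appended-cost : ∀ c → cost⁺ (empty false) c (suc k) b ≤ pot⁺ cs (occupancy c + b)
  appended-cost (empty _) = z≤n
  appended-cost (full _) = ≤-trans (≤-reflexive (shift k b)) (paid (suc b))

pot⁺-step : ∀ {K} {xs ys : Cells K} {m} → Step xs m ys → m ≢ input → ∀ b → Pot⁺Descent xs ys b
pot⁺-step input₀ ¬input b = ⊥-elim (¬input refl)
pot⁺-step input▷ ¬input b = ⊥-elim (¬input refl)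
pot⁺-step (output₀ {u}) _ b = z≤n , inj₂ (refl , λ b' → cost⁺-behind-empty true u 0 b')
pot⁺-step (output◁ {cs = cs} {cs'} {c} st) ¬input b =
  pot⁺-descent-▷ {cs = cs} {cs'} c b (pot⁺-step st ¬input (occupancy c + b))
pot⁺-step (pass◁ {cs = cs} {cs'} {c} st) ¬input b =
  pot⁺-descent-▷ {cs = cs} {cs'} c b (pot⁺-step st ¬input (occupancy c + b))
pot⁺-step (pass▷ {u = u} (input₀ {u'})) _ b =
  ≤-trans (cost⁺-behind-empty u' u 1 b) (m≤m⊔n _ _) ,
  inj₂ (refl , λ b' → ≤-trans (cost⁺-behind-empty u' u 1 b') (m≤m⊔n _ _))
pot⁺-step (pass▷ {u = u} (input▷ {k} {cs} {u'})) _ b =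
  ⊔-monoˡ-≤ _ (≤-trans (cost⁺-≤ (inputCell cs) (full false) (suc k) b) (cost⁺-behind-empty u' u (suc (suc k)) b)) ,
  inj₂ (refl , λ b' → ≤-trans (cost⁺-behind-empty u' u _ b') (m≤m⊔n _ _))

pot⁺-urgentCells : ∀ {k} (xs : Cells k) → NothingDue xs → ∀ b → pot⁺ (urgentCells xs) b ≡ pred (pot⁺ xs b)
pot⁺-urgentCells [ c ] (_ , ¬outputDue) b = cost⁺-urgentCell (empty true) c 0 b (λ (_ , due) → ¬outputDue due)
pot⁺-urgentCells (_▷_ {k} cs c) (¬due , ¬outputDue) b
  rewrite inputCell-urgentCells cs | occupancy-urgentCell c
        | pot⁺-urgentCells cs ((λ i d → ¬due i (due◁ d)) , ¬outputDue) (occupancy c + b)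
        | cost⁺-urgentCell (inputCell cs) c (suc k) b (λ { (ready , refl) → ¬due k (due▷ ready) })
  = sym (mono-≤-distrib-⊔ pred-mono-≤ (cost⁺ (inputCell cs) c (suc k) b) (pot⁺ cs (occupancy c + b)))

pot⁺≥2 : ∀ {k} (xs : Cells k) b → outputCell xs ≢ full true → 1 ≤ #full xs → 2 ≤ pot⁺ xs b
pot⁺≥2 [ full false ] b _ _ = s≤s (s≤s z≤n)
pot⁺≥2 [ full true ] b ¬outputDue _ = ⊥-elim (¬outputDue refl)
pot⁺≥2 (_▷_ {k} cs c) b ¬outputDue items with #full cs in eq
... | suc _ = ≤-trans (pot⁺≥2 cs (occupancy c + b) ¬outputDue (subst (1 ≤_) (sym eq) (s≤s z≤n))) (m≤n⊔m _ _)
... | zero with c | #full≡0⇒inputCell-empty cs eq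
...   | empty _ | _ = ⊥-elim (<-irrefl refl items)
...   | full u | u' , idle = ≤-trans last-cost (m≤m⊔n _ (pot⁺ cs (1 + b)))
  where
  last-cost : 2 ≤ cost⁺ (inputCell cs) (full u) (suc k) b
  last-cost = subst (λ l → 2 ≤ cost⁺ l (full u) (suc k) b) (sym idle)
                (≤-trans (s≤s (s≤s z≤n)) (cost⁺-behind-empty u' u (suc k) b))

cost⁻-≤ : ∀ l u x b → cost⁻ l (full u) x b ≤ suc (suc (x + (b + b)))
cost⁻-≤ (empty true)  true  x b = n≤1+n _
cost⁻-≤ (empty true)  false x b = ≤-refl
cost⁻-≤ (empty false) u     x b = ≤-refl
cost⁻-≤ (full _)      u     x b = ≤-refl

cost⁻-≥ : ∀ l u x b → suc (x + (b + b)) ≤ cost⁻ l (full u) x b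
cost⁻-≥ (empty true)  true  x b = ≤-refl
cost⁻-≥ (empty true)  false x b = n≤1+n _
cost⁻-≥ (empty false) u     x b = n≤1+n _
cost⁻-≥ (full _)      u     x b = n≤1+n _

cost⁻-lazy : ∀ l x b → cost⁻ l (full false) x b ≡ suc (suc (x + (b + b)))
cost⁻-lazy (empty true)  x b = refl
cost⁻-lazy (empty false) x b = refl
cost⁻-lazy (full _)      x b = refl

cost⁻-urgentCell : ∀ l l' c x b → cost⁻ l c x b ≤ suc (cost⁻ l' (urgentCell c) x b)
cost⁻-urgentCell l l' (empty _) x b = z≤n
cost⁻-urgentCell l l' (full u) x b = ≤-trans (cost⁻-≤ l u x b) (s≤s (cost⁻-≥ l' true x b))

cost⁻-forced-ahead : ∀ {k} {xs ys : Cells k} {m} → Forced xs m ys →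
  ∀ c x b → cost⁻ (inputCell xs) c x b ≡ cost⁻ (inputCell ys) c x b
cost⁻-forced-ahead f (empty _) x b = refl
cost⁻-forced-ahead output₀! (full _) x b = refl
cost⁻-forced-ahead (output◁! _) (full _) x b = refl
cost⁻-forced-ahead (pass◁! _) (full _) x b = refl
cost⁻-forced-ahead pass▷₀! (full _) x b = refl
cost⁻-forced-ahead pass▷! (full _) x b = refl

pot⁻-urgentCells : ∀ {k} (xs : Cells k) b → pot⁻ xs b ≤ suc (pot⁻ (urgentCells xs) b)
pot⁻-urgentCells [ c ] b = cost⁻-urgentCell (empty true) (empty true) c 0 b
pot⁻-urgentCells (_▷_ {k} cs c) b rewrite inputCell-urgentCells cs | occupancy-urgentCell c =
  ⊔-mono-≤ (cost⁻-urgentCell (inputCell cs) (urgentCell (inputCell cs)) c (suc k) b)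
           (pot⁻-urgentCells cs (occupancy c + b))

pot⁻-pass : ∀ {k} {xs ys : Cells k} {i} → Forced xs (pass i) ys → ∀ b → pot⁻ xs b ≤ pot⁻ ys b
pot⁻-pass (pass◁! {k} {c = c} f) b =
  ⊔-mono-≤ (≤-reflexive (cost⁻-forced-ahead f c (suc k) b)) (pot⁻-pass f (occupancy c + b))
pot⁻-pass pass▷₀! b = ≤-refl
pot⁻-pass (pass▷! {k} {cs}) b = ⊔-monoˡ-≤ _ (≤-reflexive (sym (cost⁻-lazy (inputCell cs) (suc k) b)))

pot⁻-output : ∀ {k} {xs ys : Cells k} → Forced xs output ys →
  ∀ B → pot⁻ xs B ≡ cost⁻ (empty true) (full true) 0 (B + #full ys) ⊔ pot⁻ ys B
pot⁻-output output₀! B rewrite +-identityʳ B = sym (⊔-identityʳ _)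
pot⁻-output (output◁! {k} {cs} {cs'} {c} f) B = begin
  cost⁻ (inputCell cs) c (suc k) B ⊔ pot⁻ cs (occupancy c + B)
    ≡⟨ cong₂ _⊔_ (cost⁻-forced-ahead f c (suc k) B) (pot⁻-output f (occupancy c + B)) ⟩
  cost⁻ (inputCell cs') c (suc k) B ⊔ (outputCost (occupancy c + B + #full cs') ⊔ pot⁻ cs' (occupancy c + B))
    ≡⟨ x∙yz≈y∙xz (cost⁻ (inputCell cs') c (suc k) B) _ (pot⁻ cs' (occupancy c + B)) ⟩
  outputCost (occupancy c + B + #full cs') ⊔ (cost⁻ (inputCell cs') c (suc k) B ⊔ pot⁻ cs' (occupancy c + B))
    ≡⟨ cong (λ t → outputCost t ⊔ (cost⁻ (inputCell cs') c (suc k) B ⊔ pot⁻ cs' (occupancy c + B)))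
            (+-shuffle (occupancy c) B (#full cs')) ⟩
  outputCost (B + (#full cs' + occupancy c)) ⊔ (cost⁻ (inputCell cs') c (suc k) B ⊔ pot⁻ cs' (occupancy c + B))
    ∎
  where
  open ≡-Reasoning
  open import Algebra.Properties.CommutativeSemigroup ⊔-commutativeSemigroup using (x∙yz≈y∙xz)
  outputCost : ℕ → ℕ
  outputCost = cost⁻ (empty true) (full true) 0

outputCost≤pot⁻ : ∀ {k} (ys : Cells k) B → 1 ≤ #full ys → outputCell ys ≡ empty false →
  cost⁻ (empty true) (full true) 0 (B + #full ys) ≤ pot⁻ ys B
outputCost≤pot⁻ [ empty _ ] B () _
outputCost≤pot⁻ [ full _ ] B _ ()
outputCost≤pot⁻ (_▷_ {k} cs c) B items idle with #full cs in eq
... | suc n =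
  ≤-trans (≤-reflexive (cong (cost⁻ (empty true) (full true) 0)
                               (sym (trans (+-shuffle (occupancy c) B (#full cs)) (cong (λ z → B + (z + occupancy c)) eq)))))
          (≤-trans (outputCost≤pot⁻ cs (occupancy c + B) (subst (1 ≤_) (sym eq) (s≤s z≤n)) idle) (m≤n⊔m _ _))
... | zero with c
...   | empty _ = ⊥-elim (<-irrefl refl items)
...   | full u = ≤-trans (last-cost cs idle) (m≤m⊔n _ _)
  where
  last-cost : ∀ {k} (cs : Cells k) → outputCell cs ≡ empty false →
    cost⁻ (empty true) (full true) 0 (B + 1) ≤ cost⁻ (inputCell cs) (full u) (suc k) B
  last-cost [ empty false ] _ rewrite +-comm B 1 = ≤-reflexive (cong (λ z → suc (suc z)) (+-suc B B))
  last-cost (_▷_ {k₀} cs₀ e) _ rewrite +-comm B 1 =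
    ≤-trans (s≤s (s≤s (≤-reflexive (+-suc B B))))
            (≤-trans (s≤s (s≤s (s≤s (m≤n+m (B + B) k₀)))) (cost⁻-≥ e u (suc (suc k₀)) B))

pot⁻-output-pred : ∀ {k} {xs ys : Cells k} → Forced xs output ys →
  ∀ B → 1 ≤ #full ys ⊎ B ≡ 0 → pred (pot⁻ xs B) ≤ pred (pot⁻ ys B)
pot⁻-output-pred {ys = ys} f B items-or-0 rewrite pot⁻-output f B with #full ys in eq | items-or-0
... | suc _ | _ = ≤-reflexive (cong pred (m≤n⇒m⊔n≡n
                    (subst (λ n → cost⁻ (empty true) (full true) 0 (B + n) ≤ pot⁻ ys B) eq
                           (outputCost≤pot⁻ ys B (subst (1 ≤_) (sym eq) (s≤s z≤n)) (output-empties f)))))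
... | zero | inj₂ refl rewrite potential-#full≡0 cost⁻ (λ _ _ _ _ → refl) ys 0 eq = z≤n

-- The users that have not yet performed `in` act as one more cell behind the input end,
-- holding the first of them while the others queue behind it.
queueCell : ℕ → Cell
queueCell zero = empty true
queueCell (suc _) = full true

Pot⁺ Pot⁻ : ∀ {k} → Cells k → ℕ → ℕ
Pot⁺ cs a = pot⁺ (cs ▷ queueCell a) (pred a)
Pot⁻ cs a = pot⁻ (cs ▷ queueCell a) (pred a)

urgentCell-queueCell : ∀ a → urgentCell (queueCell a) ≡ queueCell a
urgentCell-queueCell zero = refl
urgentCell-queueCell (suc a) = refl

Pot⁺-input : ∀ {k} (cs : Cells k) → inputCell cs ≡ full false → ∀ a → Pot⁺ cs a ≡ pot⁺ (cs ▷ empty false) a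
Pot⁺-input cs filled zero = refl
Pot⁺-input cs filled (suc a) rewrite filled = refl

Pot⁺-urgentCells : ∀ {k} (cs : Cells k) a → NothingDue (cs ▷ queueCell a) →
  Pot⁺ (urgentCells cs) a ≡ pred (Pot⁺ cs a)
Pot⁺-urgentCells cs a nothingDue =
  trans (cong (λ c → pot⁺ (urgentCells cs ▷ c) (pred a)) (sym (urgentCell-queueCell a)))
        (pot⁺-urgentCells (cs ▷ queueCell a) nothingDue (pred a))

Pot⁻-urgentCells : ∀ {k} (cs : Cells k) a → Pot⁻ cs a ≤ suc (Pot⁻ (urgentCells cs) a)
Pot⁻-urgentCells cs a =
  ≤-trans (pot⁻-urgentCells (cs ▷ queueCell a) (pred a))
          (≤-reflexive (cong (λ c → suc (pot⁻ (urgentCells cs ▷ c) (pred a))) (urgentCell-queueCell a)))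

Pot⁻-pass : ∀ {k} {cs cs' : Cells k} {i} → Forced cs (pass i) cs' → ∀ a → Pot⁻ cs a ≤ Pot⁻ cs' a
Pot⁻-pass f a = pot⁻-pass (pass◁! f) (pred a)

Pot⁻-output : ∀ {k} {cs cs' : Cells k} → Forced cs output cs' → ∀ a → pred (Pot⁻ cs a) ≤ pred (Pot⁻ cs' a)
Pot⁻-output {cs' = cs'} f a = pot⁻-output-pred (output◁! f) (pred a) (queue-items a)
  where
  queue-items : ∀ a → 1 ≤ #full (cs' ▷ queueCell a) ⊎ pred a ≡ 0
  queue-items zero = inj₂ refl
  queue-items (suc _) = inj₁ (m≤n+m 1 (#full cs'))

Pot⁻-input : ∀ {k} {cs cs' : Cells (suc k)} → Forced (cs ▷ full true) (pass (suc k)) (cs' ▷ empty false) →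
  ∀ a → Pot⁻ cs (suc a) ≤ Pot⁻ cs' a
Pot⁻-input {cs' = cs'} f a = ≤-trans (pot⁻-pass f a) (queued a)
  where
  queued : ∀ a → pot⁻ (cs' ▷ empty false) a ≤ Pot⁻ cs' a
  queued zero = ≤-refl
  queued (suc _) = m≤n⊔m _ _

queue-nothingDue : ∀ {k} (cs : Cells k) a → (∀ i → ¬ PassDue cs i) → (inputCell cs ≡ empty true → a ≡ 0) →
  outputCell cs ≢ full true → NothingDue (cs ▷ queueCell a)
queue-nothingDue cs zero ¬due _ ¬outputDue = (λ { i (due◁ d) → ¬due i d }) , ¬outputDue
queue-nothingDue cs (suc a) ¬due blocked ¬outputDue =
  (λ { i (due▷ ready) → 1+n≢0 (blocked ready) ; i (due◁ d) → ¬due i d }) , ¬outputDue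

input-due? : ∀ c a → (c ≡ empty true × Σ ℕ λ x → a ≡ suc x) ⊎ (c ≡ empty true → a ≡ 0)
input-due? (empty true) (suc x) = inj₁ (refl , x , refl)
input-due? (empty true) zero = inj₂ λ _ → refl
input-due? (empty false) a = inj₂ λ ()
input-due? (full _) a = inj₂ λ ()

data UserState : Set where
  toIn toOut toω : UserState

userProc : UserState → Proc
userProc toIn = user
userProc toOut = pre (urgent (vis outA)) (pre (urgent (vis ωA)) nil)
userProc toω = pre (urgent (vis ωA)) nil

infixl 5 _▷ᵤ_
data Users : ℕ → Set where
  ⟨_⟩ : UserState → Users 1
  _▷ᵤ_ : ∀ {m} → Users (suc m) → UserState → Users (suc (suc m))

usersProc : ∀ {n} → Users n → Proc
usersProc ⟨ s ⟩ = userProc s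
usersProc (us ▷ᵤ s) = par (usersProc us) ωset (userProc s)

isToIn isToOut : UserState → ℕ
isToIn toIn = 1
isToIn _ = 0
isToOut toOut = 1
isToOut _ = 0

#toIn #toOut : ∀ {n} → Users n → ℕ
#toIn ⟨ s ⟩ = isToIn s
#toIn (us ▷ᵤ s) = #toIn us + isToIn s
#toOut ⟨ s ⟩ = isToOut s
#toOut (us ▷ᵤ s) = #toOut us + isToOut s

data UsersStep {n} (us : Users n) : ActT → Users n → Set where
  takeIn  : ∀ {us'} → #toIn us ≡ suc (#toIn us') → #toOut us' ≡ suc (#toOut us) → UsersStep us (vis inA) us'
  takeOut : ∀ {us'} → #toIn us' ≡ #toIn us → #toOut us ≡ suc (#toOut us') → UsersStep us (vis outA) us'

usersStep-▷ᵤ : ∀ {n} {us us' : Users (suc n)} {α} s → UsersStep us α us' → UsersStep (us ▷ᵤ s) α (us' ▷ᵤ s)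
usersStep-▷ᵤ s (takeIn i o) = takeIn (cong (_+ isToIn s) i) (cong (_+ isToOut s) o)
usersStep-▷ᵤ s (takeOut i o) = takeOut (cong (_+ isToIn s) i) (cong (_+ isToOut s) o)

usersStep-◁ᵤ : ∀ {n} (us : Users (suc n)) {s s' α} → UsersStep ⟨ s ⟩ α ⟨ s' ⟩ →
  UsersStep (us ▷ᵤ s) α (us ▷ᵤ s')
usersStep-◁ᵤ us {s' = s'} (takeIn i o) =
  takeIn (trans (cong (#toIn us +_) i) (+-suc (#toIn us) (isToIn s'))) (trans (cong (#toOut us +_) o) (+-suc (#toOut us) _))
usersStep-◁ᵤ us {s' = s'} (takeOut i o) =
  takeOut (cong (#toIn us +_) i) (trans (cong (#toOut us +_) o) (+-suc (#toOut us) (isToOut s')))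

users-step-inv : ∀ {n} (us : Users n) {α Q} → usersProc us -[ α ]→ Q →
  α ≡ vis ωA ⊎ Σ (Users n) λ us' → Q ≡ usersProc us' × UsersStep us α us'
users-step-inv ⟨ toIn ⟩ preU = inj₂ (⟨ toOut ⟩ , refl , takeIn refl refl)
users-step-inv ⟨ toOut ⟩ preU = inj₂ (⟨ toω ⟩ , refl , takeOut refl refl)
users-step-inv ⟨ toω ⟩ preU = inj₁ refl
users-step-inv (us ▷ᵤ s) (parL _ st) with users-step-inv us st
... | inj₁ ω = inj₁ ω
... | inj₂ (us' , refl , step) = inj₂ (us' ▷ᵤ s , refl , usersStep-▷ᵤ s step)
users-step-inv (us ▷ᵤ s) (parR _ st) with users-step-inv ⟨ s ⟩ st
... | inj₁ ω = inj₁ ω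
... | inj₂ (⟨ s' ⟩ , refl , step) = inj₂ (us ▷ᵤ s' , refl , usersStep-◁ᵤ us step)
users-step-inv (us ▷ᵤ s) (parS {α = vis a} sync _ _) = inj₁ (cong vis (≡ᵇ-true⇒≡ a ωA sync))

users-input : ∀ {n} (us : Users n) {x} → #toIn us ≡ suc x →
  Σ (Users n) λ us' → (usersProc us -[ vis inA ]→ usersProc us') × #toIn us' ≡ x × #toOut us' ≡ suc (#toOut us)
users-input ⟨ toIn ⟩ refl = ⟨ toOut ⟩ , preU , refl , refl
users-input (us ▷ᵤ toIn) e =
  us ▷ᵤ toOut , parR refl preU , suc-injective (trans (sym (+-suc _ 0)) e) , +-suc (#toOut us) 0
users-input (us ▷ᵤ toOut) e with users-input us (trans (sym (+-identityʳ _)) e)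
... | us' , st , i , o = us' ▷ᵤ toOut , parL refl st , trans (+-identityʳ _) i , cong (_+ 1) o
users-input (us ▷ᵤ toω) e with users-input us (trans (sym (+-identityʳ _)) e)
... | us' , st , i , o = us' ▷ᵤ toω , parL refl st , trans (+-identityʳ _) i , cong (_+ 0) o

users-output : ∀ {n} (us : Users n) {x} → #toOut us ≡ suc x →
  Σ (Users n) λ us' → (usersProc us -[ vis outA ]→ usersProc us') × #toIn us' ≡ #toIn us × #toOut us' ≡ x
users-output ⟨ toOut ⟩ refl = ⟨ toω ⟩ , preU , refl , refl
users-output (us ▷ᵤ toOut) e = us ▷ᵤ toω , parR refl preU , refl , suc-injective (trans (sym (+-suc _ 0)) e)
users-output (us ▷ᵤ toIn) e with users-output us (trans (sym (+-identityʳ _)) e)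
... | us' , st , i , o = us' ▷ᵤ toIn , parL refl st , cong (_+ 1) i , trans (+-identityʳ _) o
users-output (us ▷ᵤ toω) e with users-output us (trans (sym (+-identityʳ _)) e)
... | us' , st , i , o = us' ▷ᵤ toω , parL refl st , cong (_+ 0) i , trans (+-identityʳ _) o

UsersRefuse : ∀ {n} → Users n → (Vis → Set) → Set
UsersRefuse us X =
  (1 ≤ #toIn us → ¬ X inA) × (1 ≤ #toOut us → ¬ X outA) × (#toIn us ≡ 0 → #toOut us ≡ 0 → ¬ X ωA)

usersRefusal : ∀ {n} → Users n → Vis → Set
usersRefusal us a =
  (1 ≤ #toIn us → a ≢ inA) × (1 ≤ #toOut us → a ≢ outA) × (#toIn us ≡ 0 → #toOut us ≡ 0 → a ≢ ωA)

usersRefuse-usersRefusal : ∀ {n} (us : Users n) → UsersRefuse us (usersRefusal us)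
usersRefuse-usersRefusal us =
  (λ p x → proj₁ x p refl) , (λ p x → proj₁ (proj₂ x) p refl) , (λ p q x → proj₂ (proj₂ x) p q refl)

users-refusal-inv : ∀ {n} (us : Users n) {X Q} → usersProc us =[ X ]⇒ Q → Q ≡ usersProc us × UsersRefuse us X
users-refusal-inv ⟨ toIn ⟩ (preUR ¬x) = refl , (λ _ → ¬x) , (λ ()) , (λ ())
users-refusal-inv ⟨ toOut ⟩ (preUR ¬x) = refl , (λ ()) , (λ _ → ¬x) , (λ _ ())
users-refusal-inv ⟨ toω ⟩ (preUR ¬x) = refl , (λ ()) , (λ ()) , (λ _ _ → ¬x)
users-refusal-inv (us ▷ᵤ s) {X} (parR r₁ r₂ split)
  with users-refusal-inv us r₁ | users-refusal-inv ⟨ s ⟩ r₂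
... | refl , in₁ , out₁ , ω₁ | refl , in₂ , out₂ , ω₂ = refl , ¬in , ¬out , ¬ω
  where
  ¬in : 1 ≤ #toIn us + isToIn s → ¬ X inA
  ¬in p x with split _ x
  ... | inj₂ (_ , x₁ , x₂) with 1≤+ (#toIn us) (isToIn s) p
  ...   | inj₁ q = in₁ q x₁
  ...   | inj₂ q = in₂ q x₂
  ¬out : 1 ≤ #toOut us + isToOut s → ¬ X outA
  ¬out p x with split _ x
  ... | inj₂ (_ , x₁ , x₂) with 1≤+ (#toOut us) (isToOut s) p
  ...   | inj₁ q = out₁ q x₁
  ...   | inj₂ q = out₂ q x₂
  ¬ω : #toIn us + isToIn s ≡ 0 → #toOut us + isToOut s ≡ 0 → ¬ X ωA
  ¬ω i o x with split _ x
  ... | inj₁ (_ , inj₁ x₁) = ω₁ (m+n≡0⇒m≡0 _ i) (m+n≡0⇒m≡0 _ o) x₁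
  ... | inj₁ (_ , inj₂ x₂) = ω₂ (m+n≡0⇒n≡0 (#toIn us) i) (m+n≡0⇒n≡0 (#toOut us) o) x₂

user-refusal : ∀ (s : UserState) (X : Vis → Set) → UsersRefuse ⟨ s ⟩ X → userProc s =[ X ]⇒ userProc s
user-refusal toIn X (¬in , _ , _) = preUR (¬in (s≤s z≤n))
user-refusal toOut X (_ , ¬out , _) = preUR (¬out (s≤s z≤n))
user-refusal toω X (_ , _ , ¬ω) = preUR (¬ω refl refl)

users-refusal : ∀ {n} (us : Users n) (X : Vis → Set) → UsersRefuse us X → usersProc us =[ X ]⇒ usersProc us
users-refusal ⟨ s ⟩ X h = user-refusal s X h
users-refusal (us ▷ᵤ s) X (¬in , ¬out , ¬ω) =
  parR (users-refusal us X₁ (usersRefuse-usersRefusal us)) (user-refusal s X₂ (usersRefuse-usersRefusal ⟨ s ⟩)) split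
  where
  X₁ X₂ : Vis → Set
  X₁ = usersRefusal us
  X₂ = usersRefusal ⟨ s ⟩
  ω≢in : ωA ≢ inA
  ω≢in ()
  ω≢out : ωA ≢ outA
  ω≢out ()
  -- ω is refused by the whole group iff some member still has to engage in in or out
  split-ω : X ωA → X₁ ωA ⊎ X₂ ωA
  split-ω x with #toIn us ≟ 0 | #toOut us ≟ 0 | isToIn s ≟ 0 | isToOut s ≟ 0
  ... | no i≢0 | _ | _ | _ = inj₁ ((λ _ → ω≢in) , (λ _ → ω≢out) , (λ i≡0 _ _ → i≢0 i≡0))
  ... | yes _ | no o≢0 | _ | _ = inj₁ ((λ _ → ω≢in) , (λ _ → ω≢out) , (λ _ o≡0 _ → o≢0 o≡0))
  ... | yes _ | yes _ | no i≢0 | _ = inj₂ ((λ _ → ω≢in) , (λ _ → ω≢out) , (λ i≡0 _ _ → i≢0 i≡0))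
  ... | yes _ | yes _ | yes _ | no o≢0 = inj₂ ((λ _ → ω≢in) , (λ _ → ω≢out) , (λ _ o≡0 _ → o≢0 o≡0))
  ... | yes i₁ | yes o₁ | yes i₂ | yes o₂ = ⊥-elim (¬ω (cong₂ _+_ i₁ i₂) (cong₂ _+_ o₁ o₂) x)
  split : ∀ a → X a → (ωset a ≡ true × (X₁ a ⊎ X₂ a)) ⊎ (ωset a ≡ false × X₁ a × X₂ a)
  split a x with a ≡ᵇ ωA in eq
  ... | true rewrite ≡ᵇ-true⇒≡ a ωA eq = inj₁ (refl , split-ω x)
  ... | false = inj₂ (refl , x₁ , x₂)
    where
    a≢ω : a ≢ ωA
    a≢ω = ≡ᵇ-false⇒≢ eq
    x₁ : X₁ a
    x₁ = (λ p e → ¬in (≤-trans p (m≤m+n _ _)) (subst X e x)) ,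
         (λ p e → ¬out (≤-trans p (m≤m+n _ _)) (subst X e x)) , (λ _ _ → a≢ω)
    x₂ : X₂ a
    x₂ = (λ p e → ¬in (≤-trans p (m≤n+m _ _)) (subst X e x)) ,
         (λ p e → ¬out (≤-trans p (m≤n+m _ _)) (subst X e x)) , (λ _ _ → a≢ω)

Run : Proc → ℕ → Set₁
Run P t = Σ (List Lab) λ w → Σ Proc λ P' → Steps P w P' × ¬ (ovis ωA ∈ eraseτ w) × t ≤ ζ (eraseτ w)

run-weaken : ∀ {P t t'} → t ≤ t' → Run P t' → Run P t
run-weaken t≤t' (w , P' , st , ¬ω , t'≤) = w , P' , st , ¬ω , ≤-trans t≤t' t'≤

run-τ : ∀ {P Q t} → P -[ τ ]→ Q → Run Q t → Run P t
run-τ s (w , P' , st , ¬ω , t≤) = act τ ∷ w , P' , stepA s st , ¬ω , t≤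

run-vis : ∀ {P Q a t} → a ≢ ωA → P -[ vis a ]→ Q → Run Q t → Run P t
run-vis {a = a} a≢ω s (w , P' , st , ¬ω , t≤) = act (vis a) ∷ w , P' , stepA s st , ¬ω' , t≤
  where
  ¬ω' : ¬ (ovis ωA ∈ ovis a ∷ eraseτ w)
  ¬ω' (here refl) = a≢ω refl
  ¬ω' (there p) = ¬ω p

run-tick : ∀ {P Q t} → P =[ fullTime ]⇒ Q → Run Q t → Run P (suc t)
run-tick r (w , P' , st , ¬ω , t≤) = tick ∷ w , P' , stepT r st , (λ { (there p) → ¬ω p }) , s≤s t≤

emptyCells : (k : ℕ) → Cells k
emptyCells zero = [ empty false ]
emptyCells (suc k) = emptyCells k ▷ empty false

#full-emptyCells : ∀ k → #full (emptyCells k) ≡ 0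
#full-emptyCells zero = refl
#full-emptyCells (suc k) = trans (+-identityʳ _) (#full-emptyCells k)

freshUsers : (m : ℕ) → Users (suc m)
freshUsers zero = ⟨ toIn ⟩
freshUsers (suc m) = freshUsers m ▷ᵤ toIn

usersProc-freshUsers : ∀ m → usersProc (freshUsers m) ≡ U (suc m)
usersProc-freshUsers zero = refl
usersProc-freshUsers (suc m) = cong (λ P → par P ωset user) (usersProc-freshUsers m)

#toIn-freshUsers : ∀ m → #toIn (freshUsers m) ≡ suc m
#toIn-freshUsers zero = refl
#toIn-freshUsers (suc m) = trans (cong (_+ 1) (#toIn-freshUsers m)) (+-comm (suc m) 1)

#toOut-freshUsers : ∀ m → #toOut (freshUsers m) ≡ 0
#toOut-freshUsers zero = refl
#toOut-freshUsers (suc m) = trans (+-identityʳ _) (#toOut-freshUsers m)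

initial-potential : ∀ cost → (∀ l u x b → cost l (empty u) x b ≡ 0) → ∀ k m →
  potential cost (emptyCells (suc k) ▷ queueCell (#toIn (freshUsers m))) (pred (#toIn (freshUsers m)))
    ≡ cost (empty false) (full true) (suc (suc k)) m
initial-potential cost free k m rewrite #toIn-freshUsers m =
  trans (cong (cost (empty false) (full true) (suc (suc k)) m ⊔_)
              (potential-#full≡0 cost free (emptyCells (suc k)) (suc m) (#full-emptyCells (suc k))))
        (⊔-identityʳ _)

module Pipeline (N : ℕ) (δ : ℕ → Vis)
  (δ-injective : ∀ i j → i ≤ suc N → j ≤ suc N → δ i ≡ δ j → i ≡ j)
  (δ-fresh : ∀ i → i ≤ suc N → δ i ≢ inA × δ i ≢ outA × δ i ≢ ωA) where

  inLabel outLabel : ℕ → Vis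
  inLabel j = if j ≤ᵇ N then δ j else inA
  outLabel j = if 1 ≤ᵇ j then δ (pred j) else outA

  Φcell-in : ∀ j → Φcell N δ j (vis inA) ≡ vis (inLabel j)
  Φcell-in j with j ≤ᵇ N
  ... | true = refl
  ... | false = refl

  Φcell-out : ∀ j → Φcell N δ j (vis outA) ≡ vis (outLabel j)
  Φcell-out j with 1 ≤ᵇ j
  ... | true = refl
  ... | false = refl

  inLabel-δ : ∀ j → j ≤ N → inLabel j ≡ δ j
  inLabel-δ j j≤N rewrite T⇒≡true (≤⇒≤ᵇ j≤N) = refl

  inLabel-top : inLabel (suc N) ≡ inA
  inLabel-top with suc N ≤ᵇ N in eq
  ... | true = ⊥-elim (<-irrefl refl (≤ᵇ⇒≤ (suc N) N (≡true⇒T eq)))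
  ... | false = refl

  δ≢in : ∀ i → i ≤ suc N → δ i ≢ inA
  δ≢in i p = proj₁ (δ-fresh i p)

  δ≢out : ∀ i → i ≤ suc N → δ i ≢ outA
  δ≢out i p = proj₁ (proj₂ (δ-fresh i p))

  δ-distinct : ∀ i k → i < k → k ≤ suc N → δ i ≢ δ k
  δ-distinct i k i<k k≤ e = <⇒≢ i<k (δ-injective i k (≤-trans (<⇒≤ i<k) k≤) k≤ e)

  inLabel-suc≢δ : ∀ k → k ≤ N → inLabel (suc k) ≢ δ k
  inLabel-suc≢δ k k≤N e with suc k ≤ᵇ N
  ... | true = δ-distinct k (suc k) ≤-refl (s≤s k≤N) (sym e)
  ... | false = δ≢in k (m≤n⇒m≤1+n k≤N) (sym e)

  cell : ℕ → Cell → Proc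
  cell j c = relab (cellProc c) (Φcell N δ j)

  chainProc : ∀ {k} → Cells k → Proc
  chainProc [ c ] = cell 0 c
  chainProc (_▷_ {k} cs c) = par (chainProc cs) (λ a → a ≡ᵇ δ k) (cell (suc k) c)

  label : ℕ → Move → Vis
  label k input = inLabel k
  label k output = outA
  label k (pass i) = δ i

  CellStepInv : ℕ → Cell → ActT → Proc → Set
  CellStepInv j c α Q =
    (Σ Bool λ u → c ≡ empty u × α ≡ vis (inLabel j) × Q ≡ cell j (full false)) ⊎
    (Σ Bool λ u → c ≡ full u × α ≡ vis (outLabel j) × Q ≡ cell j (empty false))

  cell-step-inv : ∀ j c {α Q} → cell j c -[ α ]→ Q → CellStepInv j c α Q
  cell-step-inv j (empty false) (rel (rec preL)) = inj₁ (false , refl , Φcell-in j , refl)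
  cell-step-inv j (empty true) (rel preU) = inj₁ (true , refl , Φcell-in j , refl)
  cell-step-inv j (full false) (rel preL) = inj₂ (false , refl , Φcell-out j , refl)
  cell-step-inv j (full true) (rel preU) = inj₂ (true , refl , Φcell-out j , refl)

  cell-input : ∀ j u → cell j (empty u) -[ vis (inLabel j) ]→ cell j (full false)
  cell-input j false = retarget (Φcell-in j) (rel (rec preL))
  cell-input j true = retarget (Φcell-in j) (rel preU)

  cell-output : ∀ j u → cell j (full u) -[ vis (outLabel j) ]→ cell j (empty false)
  cell-output j false = retarget (Φcell-out j) (rel preL)
  cell-output j true = retarget (Φcell-out j) (rel preU)

  ChainStep : ∀ {k} → Cells k → ActT → Proc → Set
  ChainStep {k} cs α Q =
    Σ Move λ m → Σ (Cells k) λ cs' → Step cs m cs' × α ≡ vis (label k m) × Q ≡ chainProc cs'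

  chain-step-inv : ∀ {k} (cs : Cells k) → k ≤ suc N → ∀ {α Q} → chainProc cs -[ α ]→ Q → ChainStep cs α Q
  chain-step-inv [ c ] _ st with cell-step-inv 0 c st
  ... | inj₁ (u , refl , α≡ , Q≡) = input , [ full false ] , input₀ , α≡ , Q≡
  ... | inj₂ (u , refl , α≡ , Q≡) = output , [ empty false ] , output₀ , α≡ , Q≡
  chain-step-inv (_▷_ {k} cs c) (s≤s k≤N) (parL ¬sync st) with chain-step-inv cs (m≤n⇒m≤1+n k≤N) st
  ... | input , _ , _ , refl , _ rewrite inLabel-δ k k≤N | ≡ᵇ-refl (δ k) with ¬sync
  ...   | ()
  chain-step-inv (_▷_ {k} cs c) (s≤s k≤N) (parL ¬sync st) | output , cs' , st' , α≡ , refl =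
    output , cs' ▷ c , output◁ st' , α≡ , refl
  chain-step-inv (_▷_ {k} cs c) (s≤s k≤N) (parL ¬sync st) | pass i , cs' , st' , α≡ , refl =
    pass i , cs' ▷ c , pass◁ st' , α≡ , refl
  chain-step-inv (_▷_ {k} cs c) (s≤s k≤N) (parR ¬sync st) with cell-step-inv (suc k) c st
  ... | inj₁ (u , refl , α≡ , refl) = input , cs ▷ full false , input▷ , α≡ , refl
  ... | inj₂ (u , refl , refl , _) rewrite ≡ᵇ-refl (δ k) with ¬sync
  ...   | ()
  chain-step-inv (_▷_ {k} cs c) (s≤s k≤N) (parS sync st₁ st₂) with cell-step-inv (suc k) c st₂
  ... | inj₁ (u , refl , refl , _) = ⊥-elim (inLabel-suc≢δ k k≤N (≡ᵇ-true⇒≡ _ _ sync))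
  ... | inj₂ (u , refl , refl , refl) with chain-step-inv cs (m≤n⇒m≤1+n k≤N) st₁
  ...   | input , cs' , st' , _ , refl = pass k , cs' ▷ empty false , pass▷ st' , refl , refl
  ...   | output , _ , _ , α≡ , _ = ⊥-elim (δ≢out k (m≤n⇒m≤1+n k≤N) (vis-injective α≡))
  ...   | pass i , _ , st' , α≡ , _ =
    ⊥-elim (δ-distinct i k (pass-index st') (m≤n⇒m≤1+n k≤N) (sym (vis-injective α≡)))

  chain-step : ∀ {k} {cs cs' : Cells k} {m} → k ≤ suc N → Step cs m cs' →
    chainProc cs -[ vis (label k m) ]→ chainProc cs'
  chain-step _ (input₀ {u}) = cell-input 0 u
  chain-step {suc k} (s≤s k≤N) (input▷ {u = u}) =
    parR (≢⇒≡ᵇ-false _ _ (inLabel-suc≢δ k k≤N)) (cell-input (suc k) u)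
  chain-step _ (output₀ {u}) = cell-output 0 u
  chain-step {suc k} (s≤s k≤N) (output◁ st) =
    parL (≢⇒≡ᵇ-false _ _ (λ e → δ≢out k (m≤n⇒m≤1+n k≤N) (sym e))) (chain-step (m≤n⇒m≤1+n k≤N) st)
  chain-step {suc k} (s≤s k≤N) (pass◁ {i = i} st) =
    parL (≢⇒≡ᵇ-false _ _ (δ-distinct i k (pass-index st) (m≤n⇒m≤1+n k≤N))) (chain-step (m≤n⇒m≤1+n k≤N) st)
  chain-step {suc k} (s≤s k≤N) (pass▷ {u = u} st) =
    parS (≡ᵇ-refl (δ k)) (retarget (cong vis (inLabel-δ k k≤N)) (chain-step (m≤n⇒m≤1+n k≤N) st))
         (cell-output (suc k) u)

  CellRefuse : ℕ → Cell → (Vis → Set) → Set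
  CellRefuse j c Y = (c ≡ empty true → ¬ Y (inLabel j)) × (c ≡ full true → ¬ Y (outLabel j))

  cellRefusal : ℕ → Cell → Vis → Set
  cellRefusal j c a = (c ≡ empty true → a ≢ inLabel j) × (c ≡ full true → a ≢ outLabel j)

  cell-refusal-inv : ∀ j c {Y Q} → cell j c =[ Y ]⇒ Q → Q ≡ cell j (urgentCell c) × CellRefuse j c Y
  cell-refusal-inv j (empty false) (relR (recR preLR)) = refl , (λ ()) , (λ ())
  cell-refusal-inv j (empty true) {Y} (relR (preUR ¬y)) =
    refl , (λ _ y → ¬y (subst (inXτ Y) (sym (Φcell-in j)) y)) , (λ ())
  cell-refusal-inv j (full false) (relR preLR) = refl , (λ ()) , (λ ())
  cell-refusal-inv j (full true) {Y} (relR (preUR ¬y)) =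
    refl , (λ ()) , (λ _ y → ¬y (subst (inXτ Y) (sym (Φcell-out j)) y))

  cell-refusal : ∀ j c Y → CellRefuse j c Y → cell j c =[ Y ]⇒ cell j (urgentCell c)
  cell-refusal j (empty false) Y _ = relR (recR preLR)
  cell-refusal j (empty true) Y (¬in , _) = relR (preUR (λ y → ¬in refl (subst (inXτ Y) (Φcell-in j) y)))
  cell-refusal j (full false) Y _ = relR preLR
  cell-refusal j (full true) Y (_ , ¬out) = relR (preUR (λ y → ¬out refl (subst (inXτ Y) (Φcell-out j) y)))

  cellRefuse-cellRefusal : ∀ j c → CellRefuse j c (cellRefusal j c)
  cellRefuse-cellRefusal j c = (λ e x → proj₁ x e refl) , (λ e x → proj₂ x e refl)

  ChainRefuse : ∀ {k} → Cells k → (Vis → Set) → Set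
  ChainRefuse {k} cs Y =
    (inputCell cs ≡ empty true → ¬ Y (inLabel k)) × (outputCell cs ≡ full true → ¬ Y outA) ×
    (∀ i → PassDue cs i → ¬ Y (δ i))

  chainRefusal : ∀ {k} → Cells k → Vis → Set
  chainRefusal {k} cs a =
    (inputCell cs ≡ empty true → a ≢ inLabel k) × (outputCell cs ≡ full true → a ≢ outA) ×
    (∀ i → PassDue cs i → a ≢ δ i)

  chainRefuse-chainRefusal : ∀ {k} (cs : Cells k) → ChainRefuse cs (chainRefusal cs)
  chainRefuse-chainRefusal cs =
    (λ e x → proj₁ x e refl) , (λ e x → proj₁ (proj₂ x) e refl) , (λ i d x → proj₂ (proj₂ x) i d refl)

  chain-refusal-inv : ∀ {k} (cs : Cells k) → k ≤ suc N → ∀ {Y Q} → chainProc cs =[ Y ]⇒ Q →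
    Q ≡ chainProc (urgentCells cs) × ChainRefuse cs Y
  chain-refusal-inv [ c ] _ r with cell-refusal-inv 0 c r
  ... | refl , ¬in , ¬out = refl , ¬in , ¬out , (λ _ ())
  chain-refusal-inv (_▷_ {k} cs c) (s≤s k≤N) {Y} (parR {X₁ = X₁} r₁ r₂ split)
    with chain-refusal-inv cs (m≤n⇒m≤1+n k≤N) r₁ | cell-refusal-inv (suc k) c r₂
  ... | refl , ¬in₁ , ¬out₁ , ¬pass₁ | refl , ¬in₂ , ¬out₂ = refl , ¬in , ¬out , ¬pass
    where
    ¬in : c ≡ empty true → ¬ Y (inLabel (suc k))
    ¬in e y with split _ y
    ... | inj₁ (sync , _) = inLabel-suc≢δ k k≤N (≡ᵇ-true⇒≡ _ _ sync)
    ... | inj₂ (_ , _ , x₂) = ¬in₂ e x₂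
    ¬out : outputCell cs ≡ full true → ¬ Y outA
    ¬out e y with split _ y
    ... | inj₁ (sync , _) = δ≢out k (m≤n⇒m≤1+n k≤N) (sym (≡ᵇ-true⇒≡ _ _ sync))
    ... | inj₂ (_ , x₁ , _) = ¬out₁ e x₁
    ¬pass : ∀ i → PassDue (cs ▷ c) i → ¬ Y (δ i)
    ¬pass i (due▷ ready) y with split _ y
    ... | inj₁ (_ , inj₁ x₁) = ¬in₁ ready (subst X₁ (sym (inLabel-δ k k≤N)) x₁)
    ... | inj₁ (_ , inj₂ x₂) = ¬out₂ refl x₂
    ... | inj₂ (¬sync , _) rewrite ≡ᵇ-refl (δ k) with ¬sync
    ...   | ()
    ¬pass i (due◁ d) y with split _ y
    ... | inj₁ (sync , _) = δ-distinct i k (passDue-index d) (m≤n⇒m≤1+n k≤N) (≡ᵇ-true⇒≡ _ _ sync)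
    ... | inj₂ (_ , x₁ , _) = ¬pass₁ i d x₁

  chain-refusal : ∀ {k} (cs : Cells k) → k ≤ suc N → (Y : Vis → Set) → ChainRefuse cs Y →
    chainProc cs =[ Y ]⇒ chainProc (urgentCells cs)
  chain-refusal [ c ] _ Y (¬in , ¬out , _) = cell-refusal 0 c Y (¬in , ¬out)
  chain-refusal (_▷_ {k} cs c) (s≤s k≤N) Y (¬in , ¬out , ¬pass) =
    parR (chain-refusal cs (m≤n⇒m≤1+n k≤N) X₁ (chainRefuse-chainRefusal cs))
         (cell-refusal (suc k) c X₂ (cellRefuse-cellRefusal (suc k) c)) split
    where
    X₁ X₂ : Vis → Set
    X₁ = chainRefusal cs
    X₂ = cellRefusal (suc k) c
    -- δ_k can only be offered by both sides when the pass is due, which Y excludes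
    split-δ : Y (δ k) → X₁ (δ k) ⊎ X₂ (δ k)
    split-δ y with due? (inputCell cs) c
    ... | inj₁ (ready , c-full) = ⊥-elim (¬pass k (subst (λ z → PassDue (cs ▷ z) k) (sym c-full) (due▷ ready)) y)
    ... | inj₂ (inj₁ ¬ready) = inj₁ ((λ ready → ⊥-elim (¬ready ready)) , (λ _ → δ≢out k (m≤n⇒m≤1+n k≤N)) ,
                              (λ i d e → δ-distinct i k (passDue-index d) (m≤n⇒m≤1+n k≤N) (sym e)))
    ... | inj₂ (inj₂ ¬full) = inj₂ ((λ _ e → inLabel-suc≢δ k k≤N (sym e)) , (λ full → ⊥-elim (¬full full)))
    split : ∀ a → Y a → ((a ≡ᵇ δ k) ≡ true × (X₁ a ⊎ X₂ a)) ⊎ ((a ≡ᵇ δ k) ≡ false × X₁ a × X₂ a)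
    split a y with a ≡ᵇ δ k in eq
    ... | true rewrite ≡ᵇ-true⇒≡ a (δ k) eq = inj₁ (refl , split-δ y)
    ... | false = inj₂ (refl , x₁ , x₂)
      where
      a≢δ : a ≢ δ k
      a≢δ = ≡ᵇ-false⇒≢ eq
      x₁ : X₁ a
      x₁ = (λ _ e → a≢δ (trans e (inLabel-δ k k≤N))) , (λ done e → ¬out done (subst Y e y)) ,
           (λ i d e → ¬pass i (due◁ d) (subst Y e y))
      x₂ : X₂ a
      x₂ = (λ e e' → ¬in e (subst Y e' y)) , (λ _ → a≢δ)

  hide-δ : ∀ i → i ≤ suc N → hideΦ N δ (vis (δ i)) ≡ τ
  hide-δ i i≤ rewrite any-applyUpTo-true (λ j → δ j ≡ᵇ δ i) id (suc (suc N)) i (s≤s i≤) (≡ᵇ-refl (δ i)) =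
    refl

  hide-in : hideΦ N δ (vis inA) ≡ vis inA
  hide-in rewrite any-applyUpTo-false (λ j → δ j ≡ᵇ inA) id (suc (suc N))
                    (λ i i< → ≢⇒≡ᵇ-false _ _ (δ≢in i (≤-pred i<))) = refl

  hide-out : hideΦ N δ (vis outA) ≡ vis outA
  hide-out rewrite any-applyUpTo-false (λ j → δ j ≡ᵇ outA) id (suc (suc N))
                     (λ i i< → ≢⇒≡ᵇ-false _ _ (δ≢out i (≤-pred i<))) = refl

  hide-inLabel-top : hideΦ N δ (vis (inLabel (suc N))) ≡ vis inA
  hide-inLabel-top = trans (cong (λ a → hideΦ N δ (vis a)) inLabel-top) hide-in

  visible : Move → ActT
  visible input = vis inA
  visible output = vis outA
  visible (pass _) = τ

  hide-label : ∀ {cs cs' : Cells (suc N)} {m} → Step cs m cs' → hideΦ N δ (vis (label (suc N) m)) ≡ visible m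
  hide-label {m = input} _ = hide-inLabel-top
  hide-label {m = output} _ = hide-out
  hide-label {m = pass i} st = hide-δ i (<⇒≤ (pass-index st))

  pipe : Cells (suc N) → Proc
  pipe cs = relab (chainProc cs) (hideΦ N δ)

  pipe-step-inv : ∀ (cs : Cells (suc N)) {α Q} → pipe cs -[ α ]→ Q →
    Σ Move λ m → Σ (Cells (suc N)) λ cs' → Step cs m cs' × α ≡ visible m × Q ≡ pipe cs'
  pipe-step-inv cs (rel st) with chain-step-inv cs ≤-refl st
  ... | m , cs' , st' , refl , refl = m , cs' , st' , hide-label st' , refl

  pipe-step : ∀ {cs cs' : Cells (suc N)} {m} → Step cs m cs' → pipe cs -[ visible m ]→ pipe cs'
  pipe-step st = retarget (hide-label st) (rel (chain-step ≤-refl st))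

  system : ∀ {n} → Cells (suc N) → Users n → Proc
  system cs us = pipe cs ∥ usersProc us

  data SystemStep {n} (cs : Cells (suc N)) (us : Users n) : Cells (suc N) → Users n → Set where
    internal : ∀ {cs' i} → Step cs (pass i) cs' → SystemStep cs us cs' us
    serveIn  : ∀ {cs' us'} → Step cs input cs' → UsersStep us (vis inA) us' → SystemStep cs us cs' us'
    serveOut : ∀ {cs' us'} → Step cs output cs' → UsersStep us (vis outA) us' → SystemStep cs us cs' us'

  system-step-inv : ∀ {n} (cs : Cells (suc N)) (us : Users n) {α Q} → system cs us -[ α ]→ Q → α ≢ vis ωA →
    Σ (Cells (suc N)) λ cs' → Σ (Users n) λ us' → Q ≡ system cs' us' × SystemStep cs us cs' us'
  system-step-inv cs us (parL ¬sync st) _ with pipe-step-inv cs st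
  ... | pass i , cs' , st' , refl , refl = cs' , us , refl , internal st'
  ... | input , _ , _ , refl , _ with ¬sync
  ...   | ()
  system-step-inv cs us (parL ¬sync st) _ | output , _ , _ , refl , _ with ¬sync
  ...   | ()
  system-step-inv cs us (parR ¬sync st) ¬ω with users-step-inv us st
  ... | inj₁ ω = ⊥-elim (¬ω ω)
  ... | inj₂ (_ , _ , takeIn _ _) with ¬sync
  ...   | ()
  system-step-inv cs us (parR ¬sync st) ¬ω | inj₂ (_ , _ , takeOut _ _) with ¬sync
  ...   | ()
  system-step-inv cs us (parS _ st₁ st₂) ¬ω with pipe-step-inv cs st₁ | users-step-inv us st₂
  ... | _ | inj₁ ω = ⊥-elim (¬ω ω)
  ... | input , cs' , st' , refl , refl | inj₂ (us' , refl , ust) = cs' , us' , refl , serveIn st' ust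
  ... | output , cs' , st' , refl , refl | inj₂ (us' , refl , ust) = cs' , us' , refl , serveOut st' ust
  ... | pass _ , _ , _ , refl , _ | inj₂ (_ , _ , ())

  system-pass : ∀ {n} {cs cs' : Cells (suc N)} {i} (us : Users n) → Step cs (pass i) cs' →
    system cs us -[ τ ]→ system cs' us
  system-pass us st = parL refl (pipe-step st)

  system-serve : ∀ {n} {cs cs' : Cells (suc N)} {us us' : Users n} {m} → Step cs m cs' →
    usersProc us -[ visible m ]→ usersProc us' → inSync notω (visible m) ≡ true →
    system cs us -[ visible m ]→ system cs' us'
  system-serve st ust sync = parS sync (pipe-step st) ust

  TimeCanPass : ∀ {n} → Cells (suc N) → Users n → Set
  TimeCanPass cs us =
    (∀ i → ¬ PassDue cs i) × (inputCell cs ≡ empty true → #toIn us ≡ 0) ×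
    (outputCell cs ≡ full true → #toOut us ≡ 0) × ¬ (#toIn us ≡ 0 × #toOut us ≡ 0)

  system-tick-inv : ∀ {n} (cs : Cells (suc N)) (us : Users n) {Q} → system cs us =[ fullTime ]⇒ Q →
    Q ≡ system (urgentCells cs) us × TimeCanPass cs us
  system-tick-inv cs us (parR {X₁ = X₁} (relR r₁) r₂ split)
    with chain-refusal-inv cs ≤-refl r₁ | users-refusal-inv us r₂
  ... | refl , ¬in₁ , ¬out₁ , ¬pass₁ | refl , ¬in₂ , ¬out₂ , ¬ω₂ =
    refl , ¬due , in-blocked , out-blocked , ¬finished
    where
    ¬due : ∀ i → ¬ PassDue cs i
    ¬due i d = ¬pass₁ i d (subst (inXτ X₁) (sym (hide-δ i (<⇒≤ (passDue-index d)))) tt)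
    in-blocked : inputCell cs ≡ empty true → #toIn us ≡ 0
    in-blocked ready with #toIn us
    ... | zero = refl
    ... | suc _ with split inA tt
    ...   | inj₁ (_ , inj₁ x₁) = ⊥-elim (¬in₁ ready (subst (inXτ X₁) (sym hide-inLabel-top) x₁))
    ...   | inj₁ (_ , inj₂ x₂) = ⊥-elim (¬in₂ (s≤s z≤n) x₂)
    out-blocked : outputCell cs ≡ full true → #toOut us ≡ 0
    out-blocked due with #toOut us
    ... | zero = refl
    ... | suc _ with split outA tt
    ...   | inj₁ (_ , inj₁ x₁) = ⊥-elim (¬out₁ due (subst (inXτ X₁) (sym hide-out) x₁))
    ...   | inj₁ (_ , inj₂ x₂) = ⊥-elim (¬out₂ (s≤s z≤n) x₂)
    ¬finished : ¬ (#toIn us ≡ 0 × #toOut us ≡ 0)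
    ¬finished (i , o) with split ωA tt
    ... | inj₂ (_ , _ , x₂) = ¬ω₂ i o x₂

  system-tick : ∀ {n} (cs : Cells (suc N)) (us : Users n) → TimeCanPass cs us →
    system cs us =[ fullTime ]⇒ system (urgentCells cs) us
  system-tick cs us (¬due , in-blocked , out-blocked , ¬finished) =
    parR (relR (chain-refusal cs ≤-refl (preimg (hideΦ N δ) X₁) refuse))
         (users-refusal us X₂ (usersRefuse-usersRefusal us)) split
    where
    X₁ X₂ : Vis → Set
    X₁ a = (inputCell cs ≡ empty true → a ≢ inA) × (outputCell cs ≡ full true → a ≢ outA)
    X₂ = usersRefusal us
    refuse : ChainRefuse cs (preimg (hideΦ N δ) X₁)
    refuse = (λ ready y → proj₁ (subst (inXτ X₁) hide-inLabel-top y) ready refl) ,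
             (λ due y → proj₂ (subst (inXτ X₁) hide-out y) due refl) ,
             (λ i d _ → ¬due i d)
    split-in : X₁ inA ⊎ X₂ inA
    split-in with #toIn us ≟ 0
    ... | yes i≡0 = inj₂ ((λ p → ⊥-elim (<-irrefl (sym i≡0) p)) , (λ _ ()) , (λ _ _ ()))
    ... | no i≢0 = inj₁ ((λ ready _ → i≢0 (in-blocked ready)) , (λ _ ()))
    split-out : X₁ outA ⊎ X₂ outA
    split-out with #toOut us ≟ 0
    ... | yes o≡0 = inj₂ ((λ _ ()) , (λ p → ⊥-elim (<-irrefl (sym o≡0) p)) , (λ _ _ ()))
    ... | no o≢0 = inj₁ ((λ _ ()) , (λ due _ → o≢0 (out-blocked due)))
    split : ∀ a → fullTime a → (notω a ≡ true × (X₁ a ⊎ X₂ a)) ⊎ (notω a ≡ false × X₁ a × X₂ a)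
    split 0 _ = inj₁ (refl , split-in)
    split 1 _ = inj₁ (refl , split-out)
    split 2 _ = inj₂ (refl , ((λ _ ()) , (λ _ ())) , ((λ _ ()) , (λ _ ()) , (λ i o _ → ¬finished (i , o))))
    split (suc (suc (suc a))) _ = inj₁ (refl , inj₁ ((λ _ ()) , (λ _ ())))

  Pot⁺-step : ∀ {n} {cs cs' : Cells (suc N)} {us us' : Users n} → SystemStep cs us cs' us' →
    Pot⁺ cs' (#toIn us') ≤ Pot⁺ cs (#toIn us)
  Pot⁺-step {us = us} (internal st) = proj₁ (pot⁺-step (pass◁ st) (λ ()) (pred (#toIn us)))
  Pot⁺-step {cs' = cs'} {us' = us'} (serveIn st (takeIn i _)) rewrite i =
    ≤-trans (≤-reflexive (Pot⁺-input cs' (input-fills st) (#toIn us')))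
            (proj₁ (pot⁺-step (pass▷ st) (λ ()) (#toIn us')))
  Pot⁺-step {us = us} (serveOut st (takeOut i _)) rewrite i = proj₁ (pot⁺-step (output◁ st) (λ ()) (pred (#toIn us)))

  #full-step : ∀ {n} {cs cs' : Cells (suc N)} {us us' : Users n} → SystemStep cs us cs' us' →
    #full cs ≡ #toOut us → #full cs' ≡ #toOut us'
  #full-step (internal st) inv = trans (#full-pass st) inv
  #full-step (serveIn st (takeIn _ o)) inv = trans (#full-input st) (trans (cong suc inv) (sym o))
  #full-step (serveOut st (takeOut _ o)) inv = suc-injective (trans (sym (#full-output st)) (trans inv o))

  Pot⁺-tick : ∀ {n} (cs : Cells (suc N)) (us : Users n) → TimeCanPass cs us → #full cs ≡ #toOut us →
    Pot⁺ (urgentCells cs) (#toIn us) ≡ pred (Pot⁺ cs (#toIn us)) × 2 ≤ Pot⁺ cs (#toIn us)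
  Pot⁺-tick cs us (¬due , in-blocked , out-blocked , ¬finished) inv =
    Pot⁺-urgentCells cs (#toIn us) (queue-nothingDue cs (#toIn us) ¬due in-blocked ¬outputDue) ,
    pot⁺≥2 (cs ▷ queueCell (#toIn us)) (pred (#toIn us)) ¬outputDue occupied
    where
    ¬outputDue : outputCell cs ≢ full true
    ¬outputDue due =
      <-irrefl refl (≤-trans (outputCell-full⇒#full≥1 cs due) (≤-reflexive (trans inv (out-blocked due))))
    occupied : 1 ≤ #full (cs ▷ queueCell (#toIn us))
    occupied with #toIn us
    ... | suc _ = m≤n+m 1 (#full cs)
    ... | zero = ≤-trans (n≢0⇒n>0 (λ none → ¬finished (refl , trans (sym inv) none))) (m≤m+n _ 0)

  ticks≤Pot⁺ : ∀ {n} (cs : Cells (suc N)) (us : Users n) {w P'} → #full cs ≡ #toOut us → Steps (system cs us) w P' →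
    ¬ (ovis ωA ∈ eraseτ w) → ζ (eraseτ w) ≤ pred (Pot⁺ cs (#toIn us))
  ticks≤Pot⁺ cs us inv done _ = z≤n
  ticks≤Pot⁺ cs us inv (stepA {α = τ} st rest) ¬ω with system-step-inv cs us st (λ ())
  ... | cs' , us' , refl , sst =
    ≤-trans (ticks≤Pot⁺ cs' us' (#full-step sst inv) rest ¬ω) (pred-mono-≤ (Pot⁺-step sst))
  ticks≤Pot⁺ cs us inv (stepA {α = vis a} st rest) ¬ω with a ≟ ωA
  ... | yes refl = ⊥-elim (¬ω (here refl))
  ... | no a≢ω with system-step-inv cs us st (a≢ω ∘ vis-injective)
  ...   | cs' , us' , refl , sst =
    ≤-trans (ticks≤Pot⁺ cs' us' (#full-step sst inv) rest (¬ω ∘ there)) (pred-mono-≤ (Pot⁺-step sst))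
  ticks≤Pot⁺ cs us inv (stepT r rest) ¬ω with system-tick-inv cs us r
  ... | refl , can with Pot⁺-tick cs us can inv
  ...   | lowered , pot≥2 =
    suc≤pred pot≥2 (subst (λ p → _ ≤ pred p) lowered
                          (ticks≤Pot⁺ (urgentCells cs) us (trans (#full-urgentCells cs) inv) rest (¬ω ∘ there)))

  -- The witnessing run performs every forced step first, then lets a waiting user input as soon
  -- as the input cell is urgent, and lets time pass only when nothing else can happen. The fuel
  -- f bounds the remaining time steps (through Pot⁺), g the actions before the next time step
  -- (through #urgent).
  ticks≥Pot⁻ : ∀ {n} f g (cs : Cells (suc N)) (us : Users n) → #full cs ≡ #toOut us →
    Pot⁺ cs (#toIn us) < f → #urgent cs < g → Run (system cs us) (pred (Pot⁻ cs (#toIn us)))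
  forced-run : ∀ {n m} f g (cs cs' : Cells (suc N)) (us : Users n) → #full cs ≡ #toOut us →
    Pot⁺ cs (#toIn us) < f → #urgent cs < g → Forced cs m cs' → Run (system cs us) (pred (Pot⁻ cs (#toIn us)))
  input-run : ∀ {n} f g (cs : Cells (suc N)) (us : Users n) {x} → #full cs ≡ #toOut us →
    Pot⁺ cs (#toIn us) < f → #urgent cs < g → inputCell cs ≡ empty true → #toIn us ≡ suc x →
    Run (system cs us) (pred (Pot⁻ cs (#toIn us)))
  tick-run : ∀ {n} f (cs : Cells (suc N)) (us : Users n) → #full cs ≡ #toOut us →
    Pot⁺ cs (#toIn us) < f → TimeCanPass cs us → Run (system cs us) (pred (Pot⁻ cs (#toIn us)))

  ticks≥Pot⁻ f g cs us inv f> g> with forced-or-nothingDue cs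
  ... | inj₁ (_ , cs' , forced) = forced-run f g cs cs' us inv f> g> forced
  ... | inj₂ (¬due , ¬outputDue) with input-due? (inputCell cs) (#toIn us)
  ...   | inj₁ (ready , _ , waiting) = input-run f g cs us inv f> g> ready waiting
  ...   | inj₂ blocked with #toIn us ≟ 0 | #toOut us ≟ 0
  ...     | yes i≡0 | yes o≡0 = [] , _ , done , (λ ()) , ≤-reflexive (cong pred finished)
    where
    finished : Pot⁻ cs (#toIn us) ≡ 0
    finished rewrite i≡0 = potential-#full≡0 cost⁻ (λ _ _ _ _ → refl) (cs ▷ empty true) 0
                             (trans (+-identityʳ _) (trans inv o≡0))
  ...     | no i≢0 | _ = tick-run f cs us inv f> (¬due , blocked , ⊥-elim ∘ ¬outputDue , λ (i , _) → i≢0 i)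
  ...     | yes _ | no o≢0 = tick-run f cs us inv f> (¬due , blocked , ⊥-elim ∘ ¬outputDue , λ (_ , o) → o≢0 o)

  forced-run {m = input} f g cs cs' us inv f> g> forced = ⊥-elim (forced-¬input forced refl)
  forced-run {m = pass i} f (suc g) cs cs' us inv f> g> forced =
    run-τ (system-pass us st)
      (run-weaken (pred-mono-≤ (Pot⁻-pass forced (#toIn us)))
        (ticks≥Pot⁻ f g cs' us (trans (#full-pass st) inv) (≤-<-trans (Pot⁺-step {us = us} (internal st)) f>)
          (<-≤-trans (forced-#urgent forced) (≤-pred g>))))
    where
    st : Step cs (pass i) cs'
    st = forced-step forced
  forced-run {m = output} f (suc g) cs cs' us inv f> g> forced
    with users-output us (trans (sym inv) (#full-output (forced-step forced)))
  ... | us' , ust , i , o =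
    run-vis (λ ()) (system-serve {us = us} {us'} st ust refl)
      (run-weaken (≤-trans (Pot⁻-output forced (#toIn us)) (≤-reflexive (cong (λ a → pred (Pot⁻ cs' a)) (sym i))))
        (ticks≥Pot⁻ f g cs' us' (sym o) (≤-<-trans (Pot⁺-step sst) f>)
          (<-≤-trans (forced-#urgent forced) (≤-pred g>))))
    where
    st : Step cs output cs'
    st = forced-step forced
    sst : SystemStep cs us cs' us'
    sst = serveOut st (takeOut i (trans (sym inv) (trans (#full-output st) (cong suc (sym o)))))

  input-run f (suc g) cs us {x} inv f> g> ready waiting with input-forced cs ready | users-input us waiting
  ... | cs' , st , fewer , forced | us' , ust , i , o =
    run-vis (λ ()) (system-serve {us = us} {us'} st ust refl)
      (run-weaken bound
        (ticks≥Pot⁻ f g cs' us' (#full-step sst inv) (≤-<-trans (Pot⁺-step sst) f>) (<-≤-trans fewer (≤-pred g>))))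
    where
    sst : SystemStep cs us cs' us'
    sst = serveIn st (takeIn (trans waiting (cong suc (sym i))) o)
    bound : pred (Pot⁻ cs (#toIn us)) ≤ pred (Pot⁻ cs' (#toIn us'))
    bound rewrite waiting | i = pred-mono-≤ (Pot⁻-input forced x)

  tick-run (suc f) cs us inv f> can with Pot⁺-tick cs us can inv
  ... | lowered , pot≥2 =
    run-weaken (pred≤suc-pred _ (Pot⁻-urgentCells cs (#toIn us)))
      (run-tick (system-tick cs us can)
        (ticks≥Pot⁻ f (suc (#urgent (urgentCells cs))) (urgentCells cs) us (trans (#full-urgentCells cs) inv)
          (subst (_< f) (sym lowered) (pred<-≤ (≤-trans (s≤s z≤n) pot≥2) (≤-pred f>))) ≤-refl))

  chainProc-emptyCells : ∀ k → chainProc (emptyCells k) ≡ chain N δ k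
  chainProc-emptyCells zero = refl
  chainProc-emptyCells (suc k) =
    cong (λ P → par P (λ a → a ≡ᵇ δ k) (cell (suc k) (empty false))) (chainProc-emptyCells k)

  system-initial : ∀ m → system (emptyCells (suc N)) (freshUsers m) ≡ Pipe N δ ∥ U (suc m)
  system-initial m =
    cong₂ (λ P Q → par (relab P (hideΦ N δ)) notω Q) (chainProc-emptyCells (suc N)) (usersProc-freshUsers m)

  response-performance : ∀ m → RPis (Pipe N δ) (suc m) (2 * suc m + (N + 1))
  response-performance m = upper , lower
    where
    cs₀ : Cells (suc N)
    cs₀ = emptyCells (suc N)
    us₀ : Users (suc m)
    us₀ = freshUsers m
    inv₀ : #full cs₀ ≡ #toOut us₀
    inv₀ = trans (#full-emptyCells (suc N)) (sym (#toOut-freshUsers m))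
    upper-value : pred (Pot⁺ cs₀ (#toIn us₀)) ≡ 2 * suc m + (N + 1)
    upper-value = trans (cong pred (initial-potential cost⁺ (λ _ _ _ _ → refl) N m)) (3+k+2m≡2[1+m]+[k+1] N m)
    lower-value : pred (Pot⁻ cs₀ (#toIn us₀)) ≡ 2 * suc m + (N + 1)
    lower-value = trans (cong pred (initial-potential cost⁻ (λ _ _ _ _ → refl) N m)) (3+k+2m≡2[1+m]+[k+1] N m)
    upper : ∀ v → InDL (Pipe N δ ∥ U (suc m)) v → ¬ (ovis ωA ∈ v) → ζ v ≤ 2 * suc m + (N + 1)
    upper v (w , P' , st , refl) ¬ω =
      ≤-trans (ticks≤Pot⁺ cs₀ us₀ inv₀ (subst (λ P → Steps P w P') (sym (system-initial m)) st) ¬ω)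
              (≤-reflexive upper-value)
    lower : Σ (List Obs) λ v → InDL (Pipe N δ ∥ U (suc m)) v × ¬ (ovis ωA ∈ v) × ζ v ≡ 2 * suc m + (N + 1)
    lower with ticks≥Pot⁻ (suc (Pot⁺ cs₀ (#toIn us₀))) (suc (#urgent cs₀)) cs₀ us₀ inv₀ ≤-refl ≤-refl
    ... | w , P' , st , ¬ω , bound =
      eraseτ w , run , ¬ω , ≤-antisym (upper _ run ¬ω) (≤-trans (≤-reflexive (sym lower-value)) bound)
      where
      run : InDL (Pipe N δ ∥ U (suc m)) (eraseτ w)
      run = w , P' , subst (λ P → Steps P w P') (system-initial m) st , refl

proposition2 : (N : ℕ) → 1 ≤ N → (δ : ℕ → Vis) →
    (∀ i j → i ≤ suc N → j ≤ suc N → δ i ≡ δ j → i ≡ j) →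
    (∀ i → i ≤ suc N → δ i ≢ inA × δ i ≢ outA × δ i ≢ ωA) →
    AsymptoticPerformance (Pipe N δ) 2 ×
    (∀ n → 1 ≤ n → RPis (Pipe N δ) n (2 * n + (N + 1)))
proposition2 N _ δ δ-injective δ-fresh = (N + 1 , asymptotic) , rp
  where
  open Pipeline N δ δ-injective δ-fresh
  rp : ∀ n → 1 ≤ n → RPis (Pipe N δ) n (2 * n + (N + 1))
  rp (suc m) _ = response-performance m
  asymptotic : ∀ n → 1 ≤ n → Σ ℕ λ k → RPis (Pipe N δ) n k × k ≤ 2 * n + (N + 1) × 2 * n ≤ k + (N + 1)
  asymptotic n n≥1 = 2 * n + (N + 1) , rp n n≥1 , ≤-refl , ≤-trans (m≤m+n (2 * n) (N + 1)) (m≤m+n _ (N + 1))
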